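{- Let $\mathcal V=\{f\in\mathcal L: f+\varphi(f)=0\}$, where $\varphi(f)^{(r)}(x_1,\dots,x_r)=(-1)^rf^{(r)}(x_r,\dots,x_1)$. For all $f,g\in\mathcal V$ we have \[\{f,g\}_{\rm ari}^{\flat}=\{f^\flat,g^\flat\}.\] In particular, $\mathcal V^\flat:=\{f^\flat: f\in\mathcal V\}$ is closed under the Ihara bracket $\{\cdot,\cdot\}$, and $f\mapsto f^\flat$ is an isomorphism of Lie algebras $(\mathcal V,\{\cdot,\cdot\}_{\rm ari})\cong(\mathcal V^\flat,\{\cdot,\cdot\})$.
   Context: For $r\ge0$ let $\mathbb Q(x_1,\dots,x_r)$ be the field of rational functions ($=\mathbb Q$ for $r=0$). For $k\in\mathbb Z$, $\mathcal Q_k$ is the set of sequences $f=(f^{(r)})_{r\ge0}$, $f^{(r)}\in\mathbb Q(x_1,\dots,x_r)$ homogeneous of degree $k-r$ (zero allowed), $\mathcal Q=\bigoplus_k\mathcal Q_k$, and $\mathcal L=\{f\in\mathcal Q: f^{(0)}=0\}$. The map $\flat$: $(f^\flat)^{(r)}(x_1,\dots,x_r)=f^{(r)}(x_1,x_2-x_1,\dots,x_r-x_{r-1})$. Ari bracket: bilinear $\odot_{\rm ari}$ with $(f\odot_{\rm ari}g)^{(n)}=\sum_{r+s=n}f^{(r)}\odot_{\rm ari}g^{(s)}$, $(f^{(r)}\odot_{\rm ari}g^{(s)})(x_1,\dots,x_{r+s})=\sum_{i=0}^s f^{(r)}(x_{i+1},\dots,x_{i+r})\,g^{(s)}(x_1,\dots,x_i,\sum_{j=i+1}^{i+r+1}x_j,x_{i+r+2},\dots,x_{r+s})-\sum_{i=1}^s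 f^{(r)}(x_{i+1},\dots,x_{i+r})\,g^{(s)}(x_1,\dots,x_{i-1},\sum_{j=i}^{i+r}x_j,x_{i+r+1},\dots,x_{r+s})$; $\{f,g\}_{\rm ari}=f\odot_{\rm ari}g-g\odot_{\rm ari}f$. Ihara bracket: bilinear $\odot$ with $(f\odot g)^{(n)}=\sum_{r+s=n}f^{(r)}\odot g^{(s)}$, where (with $x_0:=0$) $(f^{(r)}\odot g^{(s)})(x_1,\dots,x_{r+s})=\sum_{i=0}^s f^{(r)}(x_{i+1}-x_i,\dots,x_{i+r}-x_i)\,g^{(s)}(x_1,\dots,x_i,x_{i+r+1},\dots,x_{r+s})+(-1)^r\sum_{i=1}^s f^{(r)}(x_{i+r}-x_{i+r-1},\dots,x_{i+r}-x_i)\,g^{(s)}(x_1,\dots,x_{i-1},x_{i+r},\dots,x_{r+s})$; $\{f,g\}=f\odot g-g\odot f$. -}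

module Defs where

open import Data.Nat as ℕ using (ℕ; zero; suc; _∸_; _≤ᵇ_)
open import Data.Nat.Properties using (_<?_)
open import Data.Bool using (Bool; true; false; if_then_else_)
open import Data.Integer as ℤ using (ℤ; +_; -[1+_])
open import Data.Fin using (Fin; zero; suc; toℕ; fromℕ<; opposite)
open import Data.Rational as ℚ using (ℚ; 0ℚ; 1ℚ)
open import Data.List using (List; []; _∷_; foldr; map; upTo)
open import Data.List.Relation.Unary.All using (All)
open import Data.Product using (Σ; _×_; _,_)
open import Relation.Binary.PropositionalEquality using (_≡_)
open import Relation.Nullary using (¬_; yes; no)

-- Polynomials in r variables over ℚ (syntax), and polynomial identity.
-- Since ℚ is infinite, two polynomials are equal iff they agree at
-- every point of ℚ^r.

data Poly (r : ℕ) : Set where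
  con  : ℚ → Poly r
  var  : Fin r → Poly r
  _⊕_  : Poly r → Poly r → Poly r
  _⊗_  : Poly r → Poly r → Poly r
  neg  : Poly r → Poly r

infixl 6 _⊕_
infixl 7 _⊗_

Point : ℕ → Set
Point r = Fin r → ℚ

eval : ∀ {r} → Poly r → Point r → ℚ
eval (con c) x = c
eval (var i) x = x i
eval (p ⊕ q) x = eval p x ℚ.+ eval q x
eval (p ⊗ q) x = eval p x ℚ.* eval q x
eval (neg p) x = ℚ.- eval p x

_≈P_ : ∀ {r} → Poly r → Poly r → Set
p ≈P q = ∀ x → eval p x ≡ eval q x

substP : ∀ {r n} → (Fin r → Poly n) → Poly r → Poly n
substP σ (con c) = con c
substP σ (var i) = σ i
substP σ (p ⊕ q) = substP σ p ⊕ substP σ q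
substP σ (p ⊗ q) = substP σ p ⊗ substP σ q
substP σ (neg p) = neg (substP σ p)

-- Equality is
-- cross-multiplication; this is the equality of ℚ(x₁,…,x_r) whenever
-- the denominators are nonzero polynomials (guaranteed for every
-- element of 𝒬 via WF, and preserved by all operations used below).

record RatFun (r : ℕ) : Set where
  constructor _//_
  field
    num : Poly r
    den : Poly r
open RatFun public

_≈R_ : ∀ {r} → RatFun r → RatFun r → Set
f ≈R g = (num f ⊗ den g) ≈P (num g ⊗ den f)

NonZeroDen : ∀ {r} → RatFun r → Set
NonZeroDen f = ¬ (∀ x → eval (den f) x ≡ 0ℚ)

zeroR : ∀ {r} → RatFun r
zeroR = con 0ℚ // con 1ℚ

_+R_ : ∀ {r} → RatFun r → RatFun r → RatFun r
(a // b) +R (c // d) = (a ⊗ d ⊕ c ⊗ b) // (b ⊗ d)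

_*R_ : ∀ {r} → RatFun r → RatFun r → RatFun r
(a // b) *R (c // d) = (a ⊗ c) // (b ⊗ d)

negR : ∀ {r} → RatFun r → RatFun r
negR (a // b) = neg a // b

_-R_ : ∀ {r} → RatFun r → RatFun r → RatFun r
f -R g = f +R negR g

sumR : ∀ {r} → List (RatFun r) → RatFun r
sumR = foldr _+R_ zeroR

signR : ∀ {r} → ℕ → RatFun r → RatFun r
signR zero    f = f
signR (suc k) f = negR (signR k f)

substR : ∀ {r n} → (Fin r → Poly n) → RatFun r → RatFun n
substR σ (a // b) = substP σ a // substP σ b

-- Homogeneity of degree d ∈ ℤ:  f(t x₁,…,t x_r) = t^d f(x₁,…,x_r)
-- in ℚ(t,x₁,…,x_r); t is variable zero of Fin (suc r).

scaleσ : ∀ {r} → Fin r → Poly (suc r)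
scaleσ i = var zero ⊗ var (suc i)

weakσ : ∀ {r} → Fin r → Poly (suc r)
weakσ i = var (suc i)

tpowP : ∀ {r} → ℕ → Poly (suc r)
tpowP zero    = con 1ℚ
tpowP (suc n) = var zero ⊗ tpowP n

tpow : ∀ {r} → ℤ → RatFun (suc r)
tpow (+ n)     = tpowP n // con 1ℚ
tpow -[1+ n ]  = con 1ℚ // tpowP (suc n)

Homogeneous : ∀ {r} → ℤ → RatFun r → Set
Homogeneous d f = substR scaleσ f ≈R (tpow d *R substR weakσ f)

Seq : Set
Seq = (r : ℕ) → RatFun r

_≈S_ : Seq → Seq → Set
f ≈S g = ∀ r → f r ≈R g r

zeroS : Seq
zeroS r = zeroR

_+S_ : Seq → Seq → Seq
(f +S g) r = f r +R g r

WF : Seq → Set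
WF f = ∀ r → NonZeroDen (f r)

InQk : ℤ → Seq → Set
InQk k f = ∀ r → Homogeneous (k ℤ.- + r) (f r)

sumS : List (ℤ × Seq) → Seq
sumS []            = zeroS
sumS ((k , g) ∷ l) = g +S sumS l

InQ : Seq → Set
InQ f = WF f × Σ (List (ℤ × Seq)) λ l →
          All (λ kg → WF (Data.Product.proj₂ kg) × InQk (Data.Product.proj₁ kg) (Data.Product.proj₂ kg)) l
          × f ≈S sumS l

InL : Seq → Set
InL f = InQ f × f 0 ≈R zeroR

φ : Seq → Seq
φ f r = signR r (substR (λ i → var (opposite i)) (f r))

InV : Seq → Set
InV f = InL f × (f +S φ f) ≈S zeroS

-- Variables by (1-based) ℕ index: X n k = x_k for 1 ≤ k ≤ n, X n 0 = x₀ := 0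
-- (out-of-range indices never occur in the formulas below; they give 0).

X : (n : ℕ) → ℕ → Poly n
X n zero = con 0ℚ
X n (suc k) with k <? n
... | yes p = var (fromℕ< p)
... | no  _ = con 0ℚ

sumX : (n : ℕ) → ℕ → ℕ → Poly n
sumX n a b = foldr _⊕_ (con 0ℚ) (map (λ j → X n (a ℕ.+ j)) (upTo (suc b ∸ a)))

from0 : ℕ → List ℕ
from0 s = upTo (suc s)

from1 : ℕ → List ℕ
from1 s = map suc (upTo s)

pos : ∀ {m} → Fin m → ℕ
pos j = suc (toℕ j)

flat : Seq → Seq
flat f r = substR (λ j → X r (pos j) ⊕ neg (X r (toℕ j))) (f r)

ariA : ∀ n r s → RatFun r → RatFun s → ℕ → RatFun n
ariA n r s F G i =
  substR (λ j → X n (i ℕ.+ pos j)) F *R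
  substR (λ j → if pos j ≤ᵇ i then X n (pos j)
                else if pos j ≤ᵇ suc i then sumX n (suc i) (i ℕ.+ r ℕ.+ 1)
                else X n (pos j ℕ.+ r)) G

ariB : ∀ n r s → RatFun r → RatFun s → ℕ → RatFun n
ariB n r s F G i =
  substR (λ j → X n (i ℕ.+ pos j)) F *R
  substR (λ j → if pos j ≤ᵇ (i ∸ 1) then X n (pos j)
                else if pos j ≤ᵇ i then sumX n i (i ℕ.+ r)
                else X n (pos j ℕ.+ r)) G

ariTerm : ∀ n r s → RatFun r → RatFun s → RatFun n
ariTerm n r s F G =
  sumR (map (ariA n r s F G) (from0 s)) -R sumR (map (ariB n r s F G) (from1 s))

_⊙ari_ : Seq → Seq → Seq
(f ⊙ari g) n = sumR (map (λ r → ariTerm n r (n ∸ r) (f r) (g (n ∸ r))) (from0 n))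

ari : Seq → Seq → Seq
ari f g n = (f ⊙ari g) n -R (g ⊙ari f) n

ihA : ∀ n r s → RatFun r → RatFun s → ℕ → RatFun n
ihA n r s F G i =
  substR (λ j → X n (i ℕ.+ pos j) ⊕ neg (X n i)) F *R
  substR (λ j → if pos j ≤ᵇ i then X n (pos j) else X n (pos j ℕ.+ r)) G

ihB : ∀ n r s → RatFun r → RatFun s → ℕ → RatFun n
ihB n r s F G i =
  substR (λ j → X n (i ℕ.+ r) ⊕ neg (X n (i ℕ.+ r ∸ pos j))) F *R
  substR (λ j → if pos j ≤ᵇ (i ∸ 1) then X n (pos j) else X n (pos j ℕ.+ r)) G

ihTerm : ∀ n r s → RatFun r → RatFun s → RatFun n
ihTerm n r s F G =
  sumR (map (ihA n r s F G) (from0 s)) +R signR r (sumR (map (ihB n r s F G) (from1 s)))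

_⊙_ : Seq → Seq → Seq
(f ⊙ g) n = sumR (map (λ r → ihTerm n r (n ∸ r) (f r) (g (n ∸ r))) (from0 n))

ihara : Seq → Seq → Seq
ihara f g n = (f ⊙ g) n -R (g ⊙ f) n

-- Every statement is an identity of rational functions over ℚ, and ♭ is the
-- substitution x_k ↦ x_k − x_{k−1}.
-- (1) After ♭, the argument lists of the first ari sum become those of the first
-- Ihara sum: the merged block x_{i+1} + … + x_{i+r+1} telescopes to x_{i+r+1} − x_i.
-- The second ari sum becomes the second Ihara sum only after reversing the
-- arguments of f, which f + φ(f) = 0 allows at the price of the sign (−1)^r.
-- (2) For ari f g ∈ 𝒱, identities are checked at points where all denominators
-- are nonzero; this suffices because a polynomial vanishing wherever a nonzero
-- polynomial D does not is zero (restrict both to a line and count roots).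
-- Bilinearity and additivity of degrees give the grading of 𝒬. Reversing
-- x_1 … x_n maps the first sum of f ⊙ari g onto the second, up to (−1)^n,
-- leaving boundary terms f(x_{s+1} … x_n) g(x_1 … x_s) + … that are symmetric
-- in f and g and so cancel in the bracket.
-- (3) y ↦ (y_1, y_1 + y_2, …) inverts ♭ on points, so ♭ is injective.

module Submission where

open import Defs
open import Data.Bool using (Bool; true; false; if_then_else_; T)
open import Data.Empty using (⊥; ⊥-elim)
open import Data.Fin using (Fin; zero; suc; toℕ; fromℕ<; opposite)
import Data.Fin.Properties as FP
open import Data.Integer as ℤ using (ℤ)
import Data.Integer.Properties as ℤP
open import Data.List using (List; []; _∷_; foldr; map; upTo; applyUpTo; length; _++_)
import Data.List.Properties as LP
open import Data.List.Relation.Unary.All as All using (All; []; _∷_)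
import Data.List.Relation.Unary.All.Properties as AllP
open import Data.List.Relation.Unary.AllPairs using ([]; _∷_)
open import Data.List.Relation.Unary.Unique.Propositional using (Unique)
import Data.List.Relation.Unary.Unique.Propositional.Properties as UP
open import Data.Maybe using (Maybe; just; nothing)
open import Data.Nat as ℕ using (ℕ; zero; suc; _∸_; _≤ᵇ_; _≤_; _<_; z≤n; s≤s; _+_; _⊔_)
import Data.Nat.Coprimality as C
import Data.Nat.Properties as NP
import Data.Nat.Tactic.RingSolver as NS
open import Data.Product using (Σ; _×_; _,_; proj₁; proj₂)
open import Data.Rational as Q using (ℚ; 0ℚ; 1ℚ; mkℚ) renaming (_+_ to _+q_; _*_ to _*q_; -_ to -q_; _-_ to _-q_)
import Data.Rational.Properties as QP
open import Data.Sum using (_⊎_; inj₁; inj₂)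
open import Data.Unit using (tt)
open import Function using (_∘_)
open import Relation.Binary.Definitions using (tri<; tri≈; tri>)
open import Relation.Binary.PropositionalEquality
open import Relation.Nullary using (¬_; yes; no)
open import Tactic.RingSolver
open import Tactic.RingSolver.Core.AlmostCommutativeRing

ℚ-ring : AlmostCommutativeRing _ _
ℚ-ring = fromCommutativeRing QP.+-*-commutativeRing isZero
  where
  isZero : (x : ℚ) → Maybe (0ℚ ≡ x)
  isZero x with 0ℚ Q.≟ x
  ... | yes p = just p
  ... | no _  = nothing

ℤ-ring : AlmostCommutativeRing _ _
ℤ-ring = fromCommutativeRing ℤP.+-*-commutativeRing isZero
  where
  isZero : (x : ℤ) → Maybe (ℤ.+ 0 ≡ x)
  isZero x with ℤ.+ 0 ℤ.≟ x
  ... | yes p = just p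
  ... | no _  = nothing

≤⇒≤ᵇ≡true : ∀ {m n} → m ≤ n → (m ≤ᵇ n) ≡ true
≤⇒≤ᵇ≡true {m} {n} h with m ≤ᵇ n | NP.≤⇒≤ᵇ h
... | true | _ = refl

>⇒≤ᵇ≡false : ∀ {m n} → n < m → (m ≤ᵇ n) ≡ false
>⇒≤ᵇ≡false {m} {n} h with m ≤ᵇ n in eq
... | false = refl
... | true = ⊥-elim (NP.<⇒≱ h (NP.≤ᵇ⇒≤ m n (subst T (sym eq) tt)))

≡+⇒∸≡ : ∀ A B C → A ≡ C + B → A ∸ B ≡ C
≡+⇒∸≡ A B C e = trans (cong (_∸ B) e) (NP.m+n∸n≡m C B)

*≡0⇒≡0ʳ : ∀ a b → a *q b ≡ 0ℚ → a ≢ 0ℚ → b ≡ 0ℚ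
*≡0⇒≡0ʳ a b h a≢0 =
  begin
    b                    ≡⟨ sym (QP.*-identityˡ b) ⟩
    1ℚ *q b              ≡⟨ cong (_*q b) (sym (QP.*-inverseˡ a {{Q.≢-nonZero a≢0}})) ⟩
    (ia *q a) *q b       ≡⟨ QP.*-assoc ia a b ⟩
    ia *q (a *q b)       ≡⟨ cong (ia *q_) h ⟩
    ia *q 0ℚ             ≡⟨ QP.*-zeroʳ ia ⟩
    0ℚ ∎
  where
  open ≡-Reasoning
  ia = Q.1/_ a {{Q.≢-nonZero a≢0}}

*-≢0 : ∀ a b → a ≢ 0ℚ → b ≢ 0ℚ → a *q b ≢ 0ℚ
*-≢0 a b ha hb e = hb (*≡0⇒≡0ʳ a b e ha)

*≢0⇒≢0 : ∀ a b → a *q b ≢ 0ℚ → (a ≢ 0ℚ) × (b ≢ 0ℚ)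
*≢0⇒≢0 a b h = (λ e → h (trans (cong (_*q b) e) (QP.*-zeroˡ b))) , (λ e → h (trans (cong (a *q_) e) (QP.*-zeroʳ a)))

-≢0 : ∀ a b → a ≢ b → a -q b ≢ 0ℚ
-≢0 a b h e = h (trans (l a b) (trans (cong (_+q b) e) (QP.+-identityˡ b)))
  where
  l : ∀ a b → a ≡ (a -q b) +q b
  l = solve-∀ ℚ-ring

sign : ℕ → ℚ
sign zero = 1ℚ
sign (suc k) = -q sign k

sign-+ : ∀ r s → sign (r + s) ≡ sign r *q sign s
sign-+ zero s = sym (QP.*-identityˡ (sign s))
sign-+ (suc r) s = trans (cong -q_ (sign-+ r s)) (l (sign r) (sign s))
  where
  l : ∀ a b → -q (a *q b) ≡ (-q a) *q b
  l = solve-∀ ℚ-ring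

sign-square : ∀ n → sign n *q sign n ≡ 1ℚ
sign-square zero = refl
sign-square (suc n) = trans (l (sign n)) (sign-square n)
  where
  l : ∀ a → (-q a) *q (-q a) ≡ a *q a
  l = solve-∀ ℚ-ring

skew-solve : ∀ a s b → a +q s *q b ≡ 0ℚ → a ≡ (-q s) *q b
skew-solve a s b h = trans (l1 a s b) (trans (cong (_+q (-q s) *q b) h) (l2 s b))
  where
  l1 : ∀ a s b → a ≡ (a +q s *q b) +q (-q s) *q b
  l1 = solve-∀ ℚ-ring
  l2 : ∀ s b → 0ℚ +q (-q s) *q b ≡ (-q s) *q b
  l2 = solve-∀ ℚ-ring

skew-product : ∀ r s (a a' b b' : ℚ) → a ≡ (-q sign r) *q a' → b ≡ (-q sign s) *q b' → a *q b ≡ sign (r + s) *q (a' *q b')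
skew-product r s a a' b b' ea eb = trans (cong₂ _*q_ ea eb) (trans (l (sign r) (sign s) a' b') (cong (_*q (a' *q b')) (sym (sign-+ r s))))
  where
  l : ∀ p q a b → ((-q p) *q a) *q ((-q q) *q b) ≡ (p *q q) *q (a *q b)
  l = solve-∀ ℚ-ring

∑< : ℕ → (ℕ → ℚ) → ℚ
∑< zero h = 0ℚ
∑< (suc m) h = h 0 +q ∑< m (h ∘ suc)

∑<-cong : ∀ m (h h' : ℕ → ℚ) → (∀ j → j < m → h j ≡ h' j) → ∑< m h ≡ ∑< m h'
∑<-cong zero h h' H = refl
∑<-cong (suc m) h h' H = cong₂ _+q_ (H 0 (s≤s z≤n)) (∑<-cong m (h ∘ suc) (h' ∘ suc) (λ j j<m → H (suc j) (s≤s j<m)))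

∑<-zero : ∀ m (h : ℕ → ℚ) → (∀ j → j < m → h j ≡ 0ℚ) → ∑< m h ≡ 0ℚ
∑<-zero zero h H = refl
∑<-zero (suc m) h H = trans (cong₂ _+q_ (H 0 (s≤s z≤n)) (∑<-zero m (h ∘ suc) (λ j j< → H (suc j) (s≤s j<)))) (QP.+-identityˡ 0ℚ)

∑<-+ : ∀ m (h h2 h3 : ℕ → ℚ) → (∀ i → i < m → h i ≡ h2 i +q h3 i) → ∑< m h ≡ ∑< m h2 +q ∑< m h3
∑<-+ zero h h2 h3 H = solve-∀ ℚ-ring
∑<-+ (suc m) h h2 h3 H =
  trans (cong₂ _+q_ (H 0 (s≤s z≤n)) (∑<-+ m (h ∘ suc) (h2 ∘ suc) (h3 ∘ suc) (λ i i< → H (suc i) (s≤s i<))))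
        (l (h2 0) (h3 0) (∑< m (h2 ∘ suc)) (∑< m (h3 ∘ suc)))
  where
  l : ∀ a b c d → (a +q b) +q (c +q d) ≡ (a +q c) +q (b +q d)
  l = solve-∀ ℚ-ring

∑<-scale : ∀ m c (h h2 : ℕ → ℚ) → (∀ i → i < m → h i ≡ c *q h2 i) → ∑< m h ≡ c *q ∑< m h2
∑<-scale zero c h h2 H = sym (QP.*-zeroʳ c)
∑<-scale (suc m) c h h2 H =
  trans (cong₂ _+q_ (H 0 (s≤s z≤n)) (∑<-scale m c (h ∘ suc) (h2 ∘ suc) (λ i i< → H (suc i) (s≤s i<))))
        (sym (QP.*-distribˡ-+ c (h2 0) (∑< m (h2 ∘ suc))))

∑<-snoc : ∀ m (h : ℕ → ℚ) → ∑< (suc m) h ≡ ∑< m h +q h m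
∑<-snoc zero h = trans (QP.+-identityʳ (h 0)) (sym (QP.+-identityˡ (h 0)))
∑<-snoc (suc m) h = trans (cong (h 0 +q_) (∑<-snoc m (h ∘ suc))) (sym (QP.+-assoc (h 0) (∑< m (h ∘ suc)) (h (suc m))))

∑<-reverse : ∀ m (h : ℕ → ℚ) → ∑< m h ≡ ∑< m (λ i → h (m ∸ suc i))
∑<-reverse zero h = refl
∑<-reverse (suc m) h =
  trans (∑<-snoc m h)
    (trans (cong (_+q h m) (∑<-reverse m h))
      (QP.+-comm (∑< m (λ i → h (m ∸ suc i))) (h m)))

∑<-telescope : ∀ (v : ℕ → ℚ) m a → ∑< m (λ j → v (suc a + j) -q v (a + j)) ≡ v (a + m) -q v a
∑<-telescope v zero a = trans (l (v a)) (cong (λ k → v k -q v a) (sym (NP.+-identityʳ a)))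
  where
  l : ∀ z → 0ℚ ≡ z -q z
  l = solve-∀ ℚ-ring
∑<-telescope v (suc m) a =
  begin
    (v (suc a + 0) -q v (a + 0)) +q ∑< m (λ j → v (suc a + suc j) -q v (a + suc j))
  ≡⟨ cong₂ (λ p q → (v p -q v q) +q ∑< m (λ j → v (suc a + suc j) -q v (a + suc j))) (NP.+-identityʳ (suc a)) (NP.+-identityʳ a) ⟩
    (v (suc a) -q v a) +q ∑< m (λ j → v (suc a + suc j) -q v (a + suc j))
  ≡⟨ cong ((v (suc a) -q v a) +q_) (∑<-cong m _ _ (λ j _ → cong₂ (λ p q → v p -q v q) (NP.+-suc (suc a) j) (NP.+-suc a j))) ⟩
    (v (suc a) -q v a) +q ∑< m (λ j → v (suc (suc a) + j) -q v (suc a + j))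
  ≡⟨ cong ((v (suc a) -q v a) +q_) (∑<-telescope v m (suc a)) ⟩
    (v (suc a) -q v a) +q (v (suc a + m) -q v (suc a))
  ≡⟨ l (v (suc a)) (v a) (v (suc a + m)) ⟩
    v (suc a + m) -q v a
  ≡⟨ cong (λ k → v k -q v a) (sym (NP.+-suc a m)) ⟩
    v (a + suc m) -q v a
  ∎
  where
  open ≡-Reasoning
  l : ∀ p q r → (p -q q) +q (r -q p) ≡ r -q q
  l = solve-∀ ℚ-ring

∑L : ∀ {A : Set} → List A → (A → ℚ) → ℚ
∑L [] h = 0ℚ
∑L (a ∷ l) h = h a +q ∑L l h

∑L-cong : ∀ {A : Set} (l : List A) (h h' : A → ℚ) → (∀ a → h a ≡ h' a) → ∑L l h ≡ ∑L l h'
∑L-cong [] h h' H = refl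
∑L-cong (a ∷ l) h h' H = cong₂ _+q_ (H a) (∑L-cong l h h' H)

∑L-congAll : ∀ {A : Set} (l : List A) (h h' : A → ℚ) → All (λ a → h a ≡ h' a) l → ∑L l h ≡ ∑L l h'
∑L-congAll [] h h' [] = refl
∑L-congAll (a ∷ l) h h' (e ∷ es) = cong₂ _+q_ e (∑L-congAll l h h' es)

∑L-++ : ∀ {A : Set} (l l' : List A) (h : A → ℚ) → ∑L (l ++ l') h ≡ ∑L l h +q ∑L l' h
∑L-++ [] l' h = sym (QP.+-identityˡ _)
∑L-++ (a ∷ l) l' h = trans (cong (h a +q_) (∑L-++ l l' h)) (sym (QP.+-assoc (h a) (∑L l h) (∑L l' h)))

∑L-map : ∀ {A B : Set} (f : A → B) (l : List A) (h : B → ℚ) → ∑L (map f l) h ≡ ∑L l (h ∘ f)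
∑L-map f [] h = refl
∑L-map f (a ∷ l) h = cong (h (f a) +q_) (∑L-map f l h)

∑L-- : ∀ {A : Set} (l : List A) (h h' : A → ℚ) → ∑L l (λ a → h a -q h' a) ≡ ∑L l h -q ∑L l h'
∑L-- [] h h' = solve-∀ ℚ-ring
∑L-- (a ∷ l) h h' = trans (cong ((h a -q h' a) +q_) (∑L-- l h h')) (lem (h a) (h' a) (∑L l h) (∑L l h'))
  where
  lem : ∀ a b c d → (a -q b) +q (c -q d) ≡ (a +q c) -q (b +q d)
  lem = solve-∀ ℚ-ring

∑L-swap : ∀ {A B : Set} (l : List A) (l' : List B) (h : A → B → ℚ) → ∑L l (λ a → ∑L l' (h a)) ≡ ∑L l' (λ b → ∑L l (λ a → h a b))
∑L-swap [] l' h = sym (Σ0 l')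
  where
  Σ0 : ∀ {B : Set} (l' : List B) → ∑L l' (λ b → 0ℚ) ≡ 0ℚ
  Σ0 [] = refl
  Σ0 (b ∷ l') = trans (cong (0ℚ +q_) (Σ0 l')) (QP.+-identityˡ 0ℚ)
∑L-swap (a ∷ l) l' h = trans (cong (∑L l' (h a) +q_) (∑L-swap l l' h)) (sym (split l'))
  where
  split : ∀ (l' : List _) → ∑L l' (λ b → h a b +q ∑L l (λ a' → h a' b)) ≡ ∑L l' (h a) +q ∑L l' (λ b → ∑L l (λ a' → h a' b))
  split [] = sym (QP.+-identityˡ 0ℚ)
  split (b ∷ l'') = trans (cong ((h a b +q ∑L l (λ a' → h a' b)) +q_) (split l''))
                          (lem (h a b) (∑L l (λ a' → h a' b)) (∑L l'' (h a)) (∑L l'' (λ b' → ∑L l (λ a' → h a' b'))))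
    where
    lem : ∀ a b c d → (a +q b) +q (c +q d) ≡ (a +q c) +q (b +q d)
    lem = solve-∀ ℚ-ring

map-from1 : ∀ {A : Set} (h : ℕ → A) m → map h (from1 m) ≡ applyUpTo (h ∘ suc) m
map-from1 h m = trans (cong (map h) (LP.map-upTo suc m)) (LP.map-applyUpTo suc h m)

eval-subst : ∀ {r n} (σ : Fin r → Poly n) (p : Poly r) (x : Point n) →
  eval (substP σ p) x ≡ eval p (λ i → eval (σ i) x)
eval-subst σ (con c) x = refl
eval-subst σ (var i) x = refl
eval-subst σ (p ⊕ q) x = cong₂ _+q_ (eval-subst σ p x) (eval-subst σ q x)
eval-subst σ (p ⊗ q) x = cong₂ _*q_ (eval-subst σ p x) (eval-subst σ q x)
eval-subst σ (neg p) x = cong -q_ (eval-subst σ p x)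

eval-cong : ∀ {r} (p : Poly r) {x y : Point r} → (∀ i → x i ≡ y i) → eval p x ≡ eval p y
eval-cong (con c) h = refl
eval-cong (var i) h = h i
eval-cong (p ⊕ q) h = cong₂ _+q_ (eval-cong p h) (eval-cong q h)
eval-cong (p ⊗ q) h = cong₂ _*q_ (eval-cong p h) (eval-cong q h)
eval-cong (neg p) h = cong -q_ (eval-cong p h)

eval-subst² : ∀ {a b c} (σ : Fin b → Poly c) (τ : Fin a → Poly b) (p : Poly a) y →
  eval (substP σ (substP τ p)) y ≡ eval p (λ j → eval (τ j) (λ i → eval (σ i) y))
eval-subst² σ τ p y = trans (eval-subst σ (substP τ p) y) (eval-subst τ p _)

eval-num-signR : ∀ {r} k (p : RatFun r) x →
  eval (num (signR k p)) x ≡ sign k *q eval (num p) x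
eval-num-signR zero p x = sym (QP.*-identityˡ _)
eval-num-signR (suc k) p x = trans (cong -q_ (eval-num-signR k p x)) (negmul (sign k) _)
  where
  negmul : ∀ a b → -q (a *q b) ≡ (-q a) *q b
  negmul = solve-∀ ℚ-ring

den-signR : ∀ {r} k (p : RatFun r) → den (signR k p) ≡ den p
den-signR zero p = refl
den-signR (suc k) p = den-signR k p

eval-X : ∀ n k (x : Point n) (h : k < n) → eval (X n (suc k)) x ≡ x (fromℕ< h)
eval-X n k x h with k NP.<? n
... | yes p = cong x (FP.fromℕ<-cong k k refl p h)
... | no ¬p = ⊥-elim (¬p h)

eval-X-≡ : ∀ n (x : Point n) {k k'} → k ≡ k' → eval (X n k) x ≡ eval (X n k') x
eval-X-≡ n x refl = refl

pointFrom : ∀ {m n} → (ℕ → Poly n) → Point n → Point m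
pointFrom S y j = eval (S (suc (toℕ j))) y

eval-X-pointFrom : ∀ {m n} (S : ℕ → Poly n) (y : Point n) k → k ≤ m → eval (S 0) y ≡ 0ℚ →
  eval (X m k) (pointFrom {m} S y) ≡ eval (S k) y
eval-X-pointFrom S y zero h h0 = sym h0
eval-X-pointFrom {m} S y (suc k) h h0 = trans (eval-X m k (pointFrom S y) h) (cong (λ t → eval (S (suc t)) y) (FP.toℕ-fromℕ< h))

eval-sumPoly : ∀ {n} (G : ℕ → Poly n) m x → eval (foldr _⊕_ (con 0ℚ) (applyUpTo G m)) x ≡ ∑< m (λ j → eval (G j) x)
eval-sumPoly G zero x = refl
eval-sumPoly G (suc m) x = cong (eval (G 0) x +q_) (eval-sumPoly (G ∘ suc) m x)

eval-sumX : ∀ n a e (x : Point n) → eval (sumX n a e) x ≡ ∑< (suc e ∸ a) (λ j → eval (X n (a + j)) x)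
eval-sumX n a e x = trans (cong (λ l → eval (foldr _⊕_ (con 0ℚ) l) x) (LP.map-upTo (λ j → X n (a + j)) (suc e ∸ a)))
                         (eval-sumPoly (λ j → X n (a + j)) (suc e ∸ a) x)

rev : ∀ {n} → Point n → Point n
rev x i = x (opposite i)

rev-rev : ∀ {n} (x : Point n) i → rev (rev x) i ≡ x i
rev-rev x i = cong x (FP.opposite-involutive i)

eval-X-rev : ∀ n (x : Point n) k → 0 < k → k ≤ n → eval (X n k) (rev x) ≡ eval (X n (suc n ∸ k)) x
eval-X-rev (suc n) x (suc k) _ h =
  trans (eval-X (suc n) k (rev x) h)
    (trans (cong x (FP.toℕ-injective (trans (FP.opposite-prop (fromℕ< h)) (trans (cong (λ z → suc n ∸ suc z) (FP.toℕ-fromℕ< h)) (sym (FP.toℕ-fromℕ< h'))))))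
      (trans (sym (eval-X (suc n) (n ∸ k) x h')) (cong (λ z → eval (X (suc n) z) x) (sym e))))
  where
  h' : n ∸ k < suc n
  h' = s≤s (NP.m∸n≤m n k)
  e : suc n ∸ k ≡ suc (n ∸ k)
  e = NP.+-∸-assoc 1 (NP.≤-pred h)

-- Polynomial identities over ℚ

UPoly : Set
UPoly = List ℚ

evalU : UPoly → ℚ → ℚ
evalU [] t = 0ℚ
evalU (c ∷ cs) t = c +q t *q evalU cs t

addU : UPoly → UPoly → UPoly
addU [] q = q
addU (c ∷ cs) [] = c ∷ cs
addU (c ∷ cs) (d ∷ ds) = (c +q d) ∷ addU cs ds

evalU-add : ∀ p q t → evalU (addU p q) t ≡ evalU p t +q evalU q t
evalU-add [] q t = sym (QP.+-identityˡ _)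
evalU-add (c ∷ cs) [] t = sym (QP.+-identityʳ _)
evalU-add (c ∷ cs) (d ∷ ds) t rewrite evalU-add cs ds t = l c d t (evalU cs t) (evalU ds t)
  where
  l : ∀ c d t a b → (c +q d) +q t *q (a +q b) ≡ (c +q t *q a) +q (d +q t *q b)
  l = solve-∀ ℚ-ring

length-add : ∀ p q → length (addU p q) ≤ length p ⊔ length q
length-add [] q = NP.≤-refl
length-add (c ∷ cs) [] = NP.≤-refl
length-add (c ∷ cs) (d ∷ ds) = s≤s (length-add cs ds)

scaleU : ℚ → UPoly → UPoly
scaleU c = map (c *q_)

evalU-scale : ∀ c p t → evalU (scaleU c p) t ≡ c *q evalU p t
evalU-scale c [] t = sym (QP.*-zeroʳ c)
evalU-scale c (d ∷ ds) t rewrite evalU-scale c ds t = l c d t (evalU ds t)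
  where
  l : ∀ c d t a → c *q d +q t *q (c *q a) ≡ c *q (d +q t *q a)
  l = solve-∀ ℚ-ring

mulU : UPoly → UPoly → UPoly
mulU [] q = []
mulU (c ∷ cs) q = addU (scaleU c q) (0ℚ ∷ mulU cs q)

evalU-mul : ∀ p q t → evalU (mulU p q) t ≡ evalU p t *q evalU q t
evalU-mul [] q t = sym (QP.*-zeroˡ (evalU q t))
evalU-mul (c ∷ cs) q t rewrite evalU-add (scaleU c q) (0ℚ ∷ mulU cs q) t | evalU-scale c q t | evalU-mul cs q t =
  l c t (evalU cs t) (evalU q t)
  where
  l : ∀ c t a b → c *q b +q (0ℚ +q t *q (a *q b)) ≡ (c +q t *q a) *q b
  l = solve-∀ ℚ-ring

length-mul : ∀ p q → length (mulU p q) ≤ length p + length q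
length-mul [] q = z≤n
length-mul (c ∷ cs) q = NP.≤-trans (length-add (scaleU c q) (0ℚ ∷ mulU cs q))
  (NP.⊔-lub (NP.≤-trans (NP.≤-reflexive (LP.length-map _ q)) (NP.m≤n+m (length q) (suc (length cs))))
            (s≤s (length-mul cs q)))

restrictToLine : ∀ {n} → Poly n → Point n → Point n → UPoly
restrictToLine (con c) x0 d = c ∷ []
restrictToLine (var i) x0 d = x0 i ∷ d i ∷ []
restrictToLine (p ⊕ q) x0 d = addU (restrictToLine p x0 d) (restrictToLine q x0 d)
restrictToLine (p ⊗ q) x0 d = mulU (restrictToLine p x0 d) (restrictToLine q x0 d)
restrictToLine (neg p) x0 d = scaleU (-q 1ℚ) (restrictToLine p x0 d)

eval-restrictToLine : ∀ {n} (p : Poly n) x0 d t → evalU (restrictToLine p x0 d) t ≡ eval p (λ i → x0 i +q t *q d i)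
eval-restrictToLine (con c) x0 d t = l c t
  where
  l : ∀ c t → c +q t *q 0ℚ ≡ c
  l = solve-∀ ℚ-ring
eval-restrictToLine (var i) x0 d t = l (x0 i) (d i) t
  where
  l : ∀ a b t → a +q t *q (b +q t *q 0ℚ) ≡ a +q t *q b
  l = solve-∀ ℚ-ring
eval-restrictToLine (p ⊕ q) x0 d t = trans (evalU-add (restrictToLine p x0 d) (restrictToLine q x0 d) t) (cong₂ _+q_ (eval-restrictToLine p x0 d t) (eval-restrictToLine q x0 d t))
eval-restrictToLine (p ⊗ q) x0 d t = trans (evalU-mul (restrictToLine p x0 d) (restrictToLine q x0 d) t) (cong₂ _*q_ (eval-restrictToLine p x0 d t) (eval-restrictToLine q x0 d t))
eval-restrictToLine (neg p) x0 d t = trans (evalU-scale (-q 1ℚ) (restrictToLine p x0 d) t) (trans (l (evalU (restrictToLine p x0 d) t)) (cong -q_ (eval-restrictToLine p x0 d t)))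
  where
  l : ∀ a → (-q 1ℚ) *q a ≡ -q a
  l = solve-∀ ℚ-ring

lineBound : ∀ {n} → Poly n → ℕ
lineBound (con c) = 1
lineBound (var i) = 2
lineBound (p ⊕ q) = lineBound p + lineBound q
lineBound (p ⊗ q) = lineBound p + lineBound q
lineBound (neg p) = lineBound p

length-restrictToLine : ∀ {n} (p : Poly n) x0 d → length (restrictToLine p x0 d) ≤ lineBound p
length-restrictToLine (con c) x0 d = NP.≤-refl
length-restrictToLine (var i) x0 d = NP.≤-refl
length-restrictToLine (p ⊕ q) x0 d =
  NP.≤-trans (length-add (restrictToLine p x0 d) (restrictToLine q x0 d))
    (NP.⊔-lub (NP.≤-trans (length-restrictToLine p x0 d) (NP.m≤m+n _ _))
              (NP.≤-trans (length-restrictToLine q x0 d) (NP.m≤n+m _ _)))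
length-restrictToLine (p ⊗ q) x0 d = NP.≤-trans (length-mul (restrictToLine p x0 d) (restrictToLine q x0 d)) (NP.+-mono-≤ (length-restrictToLine p x0 d) (length-restrictToLine q x0 d))
length-restrictToLine (neg p) x0 d = NP.≤-trans (NP.≤-reflexive (LP.length-map ((-q 1ℚ) *q_) (restrictToLine p x0 d))) (length-restrictToLine p x0 d)

divU : ℚ → UPoly → UPoly
divU a [] = []
divU a (c ∷ []) = []
divU a (c ∷ c' ∷ cs) = evalU (c' ∷ cs) a ∷ divU a (c' ∷ cs)

div-correct : ∀ a p t → evalU p t ≡ (t -q a) *q evalU (divU a p) t +q evalU p a
div-correct a [] t = l a t
  where
  l : ∀ a t → 0ℚ ≡ (t -q a) *q 0ℚ +q 0ℚ
  l = solve-∀ ℚ-ring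
div-correct a (c ∷ []) t = l a c t
  where
  l : ∀ a c t → c +q t *q 0ℚ ≡ (t -q a) *q 0ℚ +q (c +q a *q 0ℚ)
  l = solve-∀ ℚ-ring
div-correct a (c ∷ c' ∷ cs) t rewrite div-correct a (c' ∷ cs) t =
  l a c t (evalU (c' ∷ cs) a) (evalU (divU a (c' ∷ cs)) t)
  where
  l : ∀ a c t pa q → c +q t *q ((t -q a) *q q +q pa) ≡ (t -q a) *q (pa +q t *q q) +q (c +q a *q pa)
  l = solve-∀ ℚ-ring

length-div : ∀ a p → length (divU a p) ≡ ℕ.pred (length p)
length-div a [] = refl
length-div a (c ∷ []) = refl
length-div a (c ∷ c' ∷ cs) = cong suc (length-div a (c' ∷ cs))

divide-roots : ∀ (p q : UPoly) a (ts : List ℚ) → evalU p a ≡ 0ℚ → All (a ≢_) ts →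
  All (λ t → evalU p t *q evalU q t ≡ 0ℚ) ts → All (λ t → evalU (divU a p) t *q evalU q t ≡ 0ℚ) ts
divide-roots p q a [] pa [] [] = []
divide-roots p q a (b ∷ ts) pa (ne ∷ nes) (e ∷ es) = *≡0⇒≡0ʳ (b -q a) _ chain (-≢0 b a (λ x → ne (sym x))) ∷ divide-roots p q a ts pa nes es
  where
  P' = evalU (divU a p) b
  Qb = evalU q b
  l : ∀ d P' Q → d *q (P' *q Q) ≡ (d *q P' +q 0ℚ) *q Q
  l = solve-∀ ℚ-ring
  chain : (b -q a) *q (P' *q Qb) ≡ 0ℚ
  chain = trans (l (b -q a) P' Qb) (trans (cong (λ z → ((b -q a) *q P' +q z) *q Qb) (sym pa))
            (trans (cong (_*q Qb) (sym (div-correct a p b))) e))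

swapAll : ∀ (p q : UPoly) (ts : List ℚ) → All (λ t → evalU p t *q evalU q t ≡ 0ℚ) ts → All (λ t → evalU q t *q evalU p t ≡ 0ℚ) ts
swapAll p q ts = All.map (λ {t} e → trans (QP.*-comm (evalU q t) (evalU p t)) e)

vanishDiv : ∀ a p → evalU p a ≡ 0ℚ → (∀ t → evalU (divU a p) t ≡ 0ℚ) → ∀ t → evalU p t ≡ 0ℚ
vanishDiv a p pa hq t = trans (div-correct a p t) (trans (cong₂ (λ x y → (t -q a) *q x +q y) (hq t) pa) (l (t -q a)))
  where
  l : ∀ z → z *q 0ℚ +q 0ℚ ≡ 0ℚ
  l = solve-∀ ℚ-ring

product-roots⇒zero : ∀ (p q : UPoly) (ts : List ℚ) → Unique ts → length p + length q ≤ length ts →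
  All (λ t → evalU p t *q evalU q t ≡ 0ℚ) ts → (∀ t → evalU p t ≡ 0ℚ) ⊎ (∀ t → evalU q t ≡ 0ℚ)
product-roots⇒zero [] q ts u h z = inj₁ (λ t → refl)
product-roots⇒zero (c ∷ cs) [] ts u h z = inj₂ (λ t → refl)
product-roots⇒zero (c ∷ cs) (d ∷ ds) [] u () z
product-roots⇒zero p@(c ∷ cs) q@(d ∷ ds) (a ∷ ts) (a∉ ∷ u) (s≤s h) (za ∷ z) with evalU p a Q.≟ 0ℚ
... | yes pa = fin (product-roots⇒zero (divU a p) q ts u (subst (λ z → z + length q ≤ length ts) (sym (length-div a p)) h) (divide-roots p q a ts pa a∉ z))
  where
  fin : _ → _
  fin (inj₁ hq) = inj₁ (vanishDiv a p pa hq)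
  fin (inj₂ hq) = inj₂ hq
... | no pa = fin (product-roots⇒zero p (divU a q) ts u (subst (λ z → length p + z ≤ length ts) (sym (length-div a q)) h')
                   (swapAll (divU a q) p ts (divide-roots q p a ts qa a∉ (swapAll p q ts z))))
  where
  qa : evalU q a ≡ 0ℚ
  qa = *≡0⇒≡0ʳ _ _ za pa
  h' : length p + length ds ≤ length ts
  h' = NP.≤-trans (NP.≤-reflexive (sym (NP.+-suc (length cs) (length ds)))) h
  fin : _ → _
  fin (inj₁ hq) = inj₁ hq
  fin (inj₂ hq) = inj₂ (vanishDiv a q qa hq)

ℕ→ℚ : ℕ → ℚ
ℕ→ℚ k = mkℚ (ℤ.+ k) 0 (C.sym (C.1-coprimeTo k))

ℕ→ℚ-injective : ∀ {j k} → ℕ→ℚ j ≡ ℕ→ℚ k → j ≡ k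
ℕ→ℚ-injective e = cong (λ q → ℤ.∣ Q.ℚ.numerator q ∣) e

samplePoints : ℕ → List ℚ
samplePoints M = map ℕ→ℚ (upTo M)

samplePoints-unique : ∀ M → Unique (samplePoints M)
samplePoints-unique M = UP.map⁺ ℕ→ℚ-injective (UP.upTo⁺ M)

samplePoints-length : ∀ M → length (samplePoints M) ≡ M
samplePoints-length M = trans (LP.length-map ℕ→ℚ (upTo M)) (LP.length-upTo M)

-- If E(x₀) ≠ 0 then, on the line through x₀ and any y, the restrictions of E and D
-- have a product with more roots than its degree, so D vanishes on the line.
vanishing-cancelʳ : ∀ {n} (E D : Poly n) → (∀ x → eval E x *q eval D x ≡ 0ℚ) → ¬ (∀ x → eval D x ≡ 0ℚ) → ∀ x → eval E x ≡ 0ℚ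
vanishing-cancelʳ {n} E D H nz x0 with eval E x0 Q.≟ 0ℚ
... | yes p = p
... | no ne = ⊥-elim (nz line)
  where
  line : ∀ y → eval D y ≡ 0ℚ
  line y = fin (product-roots⇒zero e δ (samplePoints M) (samplePoints-unique M) bound (All.tabulate (λ {t} _ → prod t)))
    where
    d : Point n
    d i = y i -q x0 i
    ℓ : ℚ → Point n
    ℓ t i = x0 i +q t *q d i
    e = restrictToLine E x0 d
    δ = restrictToLine D x0 d
    M = lineBound E + lineBound D
    bound : length e + length δ ≤ length (samplePoints M)
    bound = NP.≤-trans (NP.+-mono-≤ (length-restrictToLine E x0 d) (length-restrictToLine D x0 d)) (NP.≤-reflexive (sym (samplePoints-length M)))
    prod : ∀ t → evalU e t *q evalU δ t ≡ 0ℚ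
    prod t = trans (cong₂ _*q_ (eval-restrictToLine E x0 d t) (eval-restrictToLine D x0 d t)) (H (ℓ t))
    l0 : ∀ a b → a +q 0ℚ *q b ≡ a
    l0 = solve-∀ ℚ-ring
    l1 : ∀ a b → a +q 1ℚ *q (b -q a) ≡ b
    l1 = solve-∀ ℚ-ring
    fin : _ → eval D y ≡ 0ℚ
    fin (inj₁ he) = ⊥-elim (ne (trans (sym (eval-cong E (λ i → l0 (x0 i) (d i)))) (trans (sym (eval-restrictToLine E x0 d 0ℚ)) (he 0ℚ))))
    fin (inj₂ hδ) = trans (sym (eval-cong D (λ i → l1 (x0 i) (y i)))) (trans (sym (eval-restrictToLine D x0 d 1ℚ)) (hδ 1ℚ))

NonZeroP : ∀ {n} → Poly n → Set
NonZeroP p = ¬ (∀ x → eval p x ≡ 0ℚ)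

NonZeroP-⊗ : ∀ {n} (p q : Poly n) → NonZeroP p → NonZeroP q → NonZeroP (p ⊗ q)
NonZeroP-⊗ p q hp hq all0 = hp (vanishing-cancelʳ p q all0 hq)

NonZeroP-1 : ∀ {n} → NonZeroP {n} (con 1ℚ)
NonZeroP-1 h with h (λ _ → 0ℚ)
... | ()

NonZeroP-den-sum : ∀ {n} (h : ℕ → RatFun n) m → (∀ i → i < m → NonZeroP (den (h i))) → NonZeroP (den (sumR (applyUpTo h m)))
NonZeroP-den-sum h zero H = NonZeroP-1
NonZeroP-den-sum h (suc m) H = NonZeroP-⊗ (den (h 0)) (den (sumR (applyUpTo (h ∘ suc) m))) (H 0 (s≤s z≤n)) (NonZeroP-den-sum (h ∘ suc) m (λ i i< → H (suc i) (s≤s i<)))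

NonZeroP-den-≡ : ∀ {n} {p q : RatFun n} → p ≡ q → NonZeroP (den p) → NonZeroP (den q)
NonZeroP-den-≡ refl h = h

Surjective : ∀ {m n} → (Fin m → Poly n) → Set
Surjective {m} {n} σ = ∀ (y : Point m) → Σ (Point n) λ x → ∀ j → eval (σ j) x ≡ y j

NonZeroP-subst : ∀ {m n} (σ : Fin m → Poly n) → Surjective σ → (p : Poly m) → NonZeroP p → NonZeroP (substP σ p)
NonZeroP-subst σ ri p nz all0 = nz λ y →
  trans (sym (eval-cong p (proj₂ (ri y)))) (trans (sym (eval-subst σ p (proj₁ (ri y)))) (all0 (proj₁ (ri y))))

surjective-reverse : ∀ {n} → Surjective {n} {n} (λ i → var (opposite i))
surjective-reverse y = (λ i → y (opposite i)) , λ j → cong y (FP.opposite-involutive j)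

-- p = c · q, cross-multiplied; c absorbs the sign produced by reversing a φ-skew argument.
record Scaled {r : ℕ} (c : ℚ) (p q : RatFun r) : Set where
  constructor scaled
  field holds : ∀ x → eval (num p) x *q eval (den q) x ≡ c *q (eval (num q) x *q eval (den p) x)

Scaled-+ : ∀ {r} {c} {p q p' q' : RatFun r} → Scaled c p q → Scaled c p' q' → Scaled c (p +R p') (q +R q')
Scaled-+ {c = c} {p} {q} {p'} {q'} (scaled h) (scaled h') = scaled λ x →
  let a = eval (num p) x ; b = eval (den p) x ; a' = eval (num p') x ; b' = eval (den p') x
      e = eval (num q) x ; f = eval (den q) x ; e' = eval (num q') x ; f' = eval (den q') x
  in trans (l1 a b a' b' f f') (trans (cong₂ (λ u v → u *q (b' *q f') +q v *q (b *q f)) (h x) (h' x)) (l2 c e b b' f e' f'))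
  where
  l1 : ∀ a b a' b' f f' → (a *q b' +q a' *q b) *q (f *q f') ≡ (a *q f) *q (b' *q f') +q (a' *q f') *q (b *q f)
  l1 = solve-∀ ℚ-ring
  l2 : ∀ c e b b' f e' f' → (c *q (e *q b)) *q (b' *q f') +q (c *q (e' *q b')) *q (b *q f) ≡ c *q ((e *q f' +q e' *q f) *q (b *q b'))
  l2 = solve-∀ ℚ-ring

Scaled-* : ∀ {r} {c} {p q p' q' : RatFun r} → Scaled c p q → Scaled 1ℚ p' q' → Scaled c (p *R p') (q *R q')
Scaled-* {c = c} {p} {q} {p'} {q'} (scaled h) (scaled h') = scaled λ x →
  let a = eval (num p) x ; b = eval (den p) x ; a' = eval (num p') x ; b' = eval (den p') x
      e = eval (num q) x ; f = eval (den q) x ; e' = eval (num q') x ; f' = eval (den q') x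
  in trans (l1 a a' f f') (trans (cong₂ _*q_ (h x) (h' x)) (l2 c e b e' b'))
  where
  l1 : ∀ a a' f f' → (a *q a') *q (f *q f') ≡ (a *q f) *q (a' *q f')
  l1 = solve-∀ ℚ-ring
  l2 : ∀ c e b e' b' → (c *q (e *q b)) *q (1ℚ *q (e' *q b')) ≡ c *q ((e *q e') *q (b *q b'))
  l2 = solve-∀ ℚ-ring

Scaled-neg : ∀ {r} {c} {p q : RatFun r} → Scaled c p q → Scaled c (negR p) (negR q)
Scaled-neg {c = c} {p} {q} (scaled h) = scaled λ x →
  trans (l1 (eval (num p) x) (eval (den q) x)) (trans (cong -q_ (h x)) (l2 c (eval (num q) x) (eval (den p) x)))
  where
  l1 : ∀ a f → (-q a) *q f ≡ -q (a *q f)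
  l1 = solve-∀ ℚ-ring
  l2 : ∀ c e b → -q (c *q (e *q b)) ≡ c *q ((-q e) *q b)
  l2 = solve-∀ ℚ-ring

Scaled-zero : ∀ {r} {c} → Scaled {r} c zeroR zeroR
Scaled-zero {c = c} = scaled λ x → l c
  where
  l : ∀ c → 0ℚ *q 1ℚ ≡ c *q (0ℚ *q 1ℚ)
  l = solve-∀ ℚ-ring

Scaled-eval : ∀ {r} {p q : RatFun r} → (∀ x → eval (num p) x ≡ eval (num q) x) → (∀ x → eval (den p) x ≡ eval (den q) x) → Scaled 1ℚ p q
Scaled-eval {p = p} {q} hn hd = scaled λ x → trans (cong₂ _*q_ (hn x) (sym (hd x))) (sym (QP.*-identityˡ _))

Scaled⇒≈R : ∀ {r} {p q : RatFun r} → Scaled 1ℚ p q → p ≈R q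
Scaled⇒≈R (scaled h) x = trans (h x) (QP.*-identityˡ _)

Scaled-neg-sign : ∀ {r} k {p q : RatFun r} → Scaled (-q sign k) p q → Scaled 1ℚ (negR p) (signR k q)
Scaled-neg-sign k {p} {q} (scaled h) = scaled λ x → lem x
  where
  l0 : ∀ a f → (-q a) *q f ≡ -q (a *q f)
  l0 = solve-∀ ℚ-ring
  l : ∀ s e b → -q ((-q s) *q (e *q b)) ≡ 1ℚ *q ((s *q e) *q b)
  l = solve-∀ ℚ-ring
  lem : ∀ x → eval (num (negR p)) x *q eval (den (signR k q)) x ≡ 1ℚ *q (eval (num (signR k q)) x *q eval (den (negR p)) x)
  lem x rewrite den-signR k q | eval-num-signR k q x =
    trans (l0 (eval (num p) x) (eval (den q) x)) (trans (cong -q_ (h x)) (l (sign k) (eval (num q) x) (eval (den p) x)))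

Scaled-≡ : ∀ {r c} {P P' Q Q' : RatFun r} → P ≡ P' → Q ≡ Q' → Scaled c P Q → Scaled c P' Q'
Scaled-≡ refl refl h = h

Scaled-substR-sum : ∀ {r n} {c} (σ : Fin r → Poly n) (h : ℕ → RatFun r) (h' : ℕ → RatFun n) m → (∀ j → j < m → Scaled c (substR σ (h j)) (h' j)) →
  Scaled c (substR σ (sumR (applyUpTo h m))) (sumR (applyUpTo h' m))
Scaled-substR-sum σ h h' zero H = Scaled-zero
Scaled-substR-sum σ h h' (suc m) H = Scaled-+ (H 0 (s≤s z≤n)) (Scaled-substR-sum σ (h ∘ suc) (h' ∘ suc) m (λ j j<m → H (suc j) (s≤s j<m)))

Scaled-subst² : ∀ {a b c d} (σ : Fin b → Poly c) (τ : Fin a → Poly b) (τ' : Fin d → Poly c) (ρ : Fin a → Poly d) (P : RatFun a) →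
  (∀ y j → eval (τ j) (λ i → eval (σ i) y) ≡ eval (ρ j) (λ i → eval (τ' i) y)) →
  Scaled 1ℚ (substR σ (substR τ P)) (substR τ' (substR ρ P))
Scaled-subst² σ τ τ' ρ P H = Scaled-eval
  (λ y → trans (eval-subst² σ τ (num P) y) (trans (eval-cong (num P) (H y)) (sym (eval-subst² τ' ρ (num P) y))))
  (λ y → trans (eval-subst² σ τ (den P) y) (trans (eval-cong (den P) (H y)) (sym (eval-subst² τ' ρ (den P) y))))

-- Component r of f + φ f = 0, cross-multiplied: F(u) = −(−1)^r F(u_r, …, u_1).
φ-Skew : ∀ {r} → RatFun r → Set
φ-Skew {r} F = ∀ u → eval (num F) u *q eval (den F) (rev u) +q sign r *q (eval (num F) (rev u) *q eval (den F) u) ≡ 0ℚ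

φ-skew-component : ∀ (f : Seq) → (f +S φ f) ≈S zeroS → ∀ r → φ-Skew (f r)
φ-skew-component f h r u = trans (sym (QP.*-identityʳ _)) (trans (lem (h r u)) (QP.*-zeroˡ (eval (den (F +R φ f r)) u)))
  where
  F : RatFun r
  F = f r
  lem : eval (num (F +R φ f r) ⊗ con 1ℚ) u ≡ eval (con 0ℚ ⊗ den (F +R φ f r)) u →
        (eval (num F) u *q eval (den F) (rev u) +q sign r *q (eval (num F) (rev u) *q eval (den F) u)) *q 1ℚ
        ≡ 0ℚ *q eval (den (F +R φ f r)) u
  lem e rewrite den-signR r (substR (λ i → var (opposite i)) F) | eval-num-signR r (substR (λ i → var (opposite i)) F) u
              | eval-subst (λ i → var (opposite i)) (num F) u | eval-subst (λ i → var (opposite i)) (den F) u =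
    trans (cong (λ z → (eval (num F) u *q eval (den F) (rev u) +q z) *q 1ℚ)
                (sym (QP.*-assoc (sign r) (eval (num F) (rev u)) (eval (den F) u)))) e

Scaled-subst²-reversed : ∀ {a b c d} (σ : Fin b → Poly c) (τ : Fin a → Poly b) (τ' : Fin d → Poly c) (ρ : Fin a → Poly d) (F : RatFun a) → φ-Skew F →
  (∀ y j → eval (ρ j) (λ k → eval (τ' k) y) ≡ eval (τ (opposite j)) (λ k → eval (σ k) y)) →
  Scaled (-q sign a) (substR σ (substR τ F)) (substR τ' (substR ρ F))
Scaled-subst²-reversed {a} σ τ τ' ρ F skewF H = scaled λ y →
  let uL = λ j → eval (τ j) (λ k → eval (σ k) y)
      uR = λ j → eval (ρ j) (λ k → eval (τ' k) y)
      uLo = rev uL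
      eN : eval (num F) uR ≡ eval (num F) uLo
      eN = eval-cong (num F) (H y)
      eD : eval (den F) uR ≡ eval (den F) uLo
      eD = eval-cong (den F) (H y)
  in trans (cong₂ _*q_ (eval-subst² σ τ (num F) y) (trans (eval-subst² τ' ρ (den F) y) eD))
     (trans (skew-solve _ (sign a) _ (skewF uL))
            (cong₂ (λ z w → (-q sign a) *q (z *q w)) (sym (trans (eval-subst² τ' ρ (num F) y) eN)) (sym (eval-subst² σ τ (den F) y))))

-- ♭ turns ari into the Ihara bracket

flatσ : ∀ m → Fin m → Poly m
flatσ m j = X m (pos j) ⊕ neg (X m (toℕ j))

flatAt : ∀ n → ℕ → Poly n
flatAt n k = X n k ⊕ neg (X n (k ∸ 1))

eval-X-flat : ∀ n (y : Point n) k → k ≤ n → eval (X n k) (pointFrom {n} (flatAt n) y) ≡ eval (X n k) y -q eval (X n (k ∸ 1)) y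
eval-X-flat n y k h = eval-X-pointFrom (flatAt n) y k h (solve-∀ ℚ-ring)

eval-origin-shift : ∀ n i (y : Point n) → eval (X n (i + 0) ⊕ neg (X n i)) y ≡ 0ℚ
eval-origin-shift n i y rewrite NP.+-identityʳ i = xmx (eval (X n i) y)
  where
  xmx : ∀ a → a +q -q a ≡ 0ℚ
  xmx = solve-∀ ℚ-ring

flat-ariF : ∀ n r i (y : Point n) (j : Fin r) → i + r ≤ n →
  eval (X n (i + pos j)) (pointFrom (flatAt n) y) ≡ eval (flatσ r j) (pointFrom {r} (λ k → X n (i + k) ⊕ neg (X n i)) y)
flat-ariF n r i y j h =
  begin
    eval (X n (i + pos j)) (pointFrom (flatAt n) y)
  ≡⟨ eval-X-flat n y (i + pos j) b1 ⟩
    v (i + pos j) -q v (i + pos j ∸ 1)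
  ≡⟨ cong (λ k → v (i + pos j) -q v (k ∸ 1)) (NP.+-suc i (toℕ j)) ⟩
    v (i + pos j) -q v (i + toℕ j)
  ≡⟨ l (v (i + pos j)) (v (i + toℕ j)) (v i) ⟩
    (v (i + pos j) -q v i) +q -q (v (i + toℕ j) -q v i)
  ≡⟨ sym (cong₂ (λ p q → p +q -q q) (eval-X-pointFrom Tt y (pos j) (FP.toℕ<n j) (eval-origin-shift n i y))
                                     (eval-X-pointFrom Tt y (toℕ j) (NP.<⇒≤ (FP.toℕ<n j)) (eval-origin-shift n i y))) ⟩
    eval (flatσ r j) (pointFrom {r} Tt y)
  ∎
  where
  open ≡-Reasoning
  Tt = λ k → X n (i + k) ⊕ neg (X n i)
  v = λ k → eval (X n k) y
  b1 : i + pos j ≤ n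
  b1 = NP.≤-trans (NP.+-monoʳ-≤ i (FP.toℕ<n j)) h
  l : ∀ a b c → a -q b ≡ (a -q c) +q -q (b -q c)
  l = solve-∀ ℚ-ring

ariGArg : ∀ n r → ℕ → ℕ → ℕ → Poly n
ariGArg n r i e k = if k ≤ᵇ i then X n k else if k ≤ᵇ suc i then sumX n (suc i) e else X n (k + r)

ihGArg : ∀ n r → ℕ → ℕ → Poly n
ihGArg n r i k = if k ≤ᵇ i then X n k else X n (k + r)

ariGArg-below : ∀ n r i e k → k ≤ i → ariGArg n r i e k ≡ X n k
ariGArg-below n r i e k h rewrite ≤⇒≤ᵇ≡true h = refl

ariGArg-merged : ∀ n r i e → ariGArg n r i e (suc i) ≡ sumX n (suc i) e
ariGArg-merged n r i e rewrite >⇒≤ᵇ≡false {suc i} {i} NP.≤-refl | ≤⇒≤ᵇ≡true {suc i} {suc i} NP.≤-refl = refl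

ariGArg-above : ∀ n r i e k → suc i < k → ariGArg n r i e k ≡ X n (k + r)
ariGArg-above n r i e k h rewrite >⇒≤ᵇ≡false {k} {i} (NP.<-trans (NP.n<1+n i) h) | >⇒≤ᵇ≡false {k} {suc i} h = refl

ihGArg-below : ∀ n r i k → k ≤ i → ihGArg n r i k ≡ X n k
ihGArg-below n r i k h rewrite ≤⇒≤ᵇ≡true h = refl

ihGArg-above : ∀ n r i k → i < k → ihGArg n r i k ≡ X n (k + r)
ihGArg-above n r i k h rewrite >⇒≤ᵇ≡false {k} {i} h = refl

eval-flat-sumX : ∀ n r i (y : Point n) → i + suc r ≤ n →
  eval (sumX n (suc i) (i + suc r)) (pointFrom (flatAt n) y) ≡ eval (X n (i + suc r)) y -q eval (X n i) y
eval-flat-sumX n r i y h =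
  begin
    eval (sumX n (suc i) (i + suc r)) (pointFrom (flatAt n) y)
  ≡⟨ eval-sumX n (suc i) (i + suc r) _ ⟩
    ∑< (suc (i + suc r) ∸ suc i) (λ j → eval (X n (suc i + j)) (pointFrom (flatAt n) y))
  ≡⟨ cong (λ m → ∑< m (λ j → eval (X n (suc i + j)) (pointFrom (flatAt n) y))) (NP.m+n∸m≡n i (suc r)) ⟩
    ∑< (suc r) (λ j → eval (X n (suc i + j)) (pointFrom (flatAt n) y))
  ≡⟨ ∑<-cong (suc r) _ _ (λ j j<r → eval-X-flat n y (suc i + j) (NP.≤-trans (s≤s (NP.+-monoʳ-≤ i (NP.≤-pred j<r))) (NP.≤-trans (NP.≤-reflexive (sym (NP.+-suc i r))) h))) ⟩
    ∑< (suc r) (λ j → v (suc i + j) -q v (i + j))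
  ≡⟨ ∑<-telescope v (suc r) i ⟩
    v (i + suc r) -q v i
  ∎
  where
  open ≡-Reasoning
  v = λ k → eval (X n k) y

flat-ariG : ∀ n r s i e (y : Point n) (j : Fin s) → i ≤ s → r + s ≤ n → e ≡ i + suc r →
  eval (ariGArg n r i e (pos j)) (pointFrom (flatAt n) y) ≡ eval (flatσ s j) (pointFrom {s} (ihGArg n r i) y)
flat-ariG n r s i e y j hi hn he =
  trans (lhs (NP.<-cmp t i))
        (sym (cong₂ (λ p q → p +q -q q) (eval-X-pointFrom (ihGArg n r i) y (pos j) (FP.toℕ<n j) refl)
                                         (eval-X-pointFrom (ihGArg n r i) y t (NP.<⇒≤ (FP.toℕ<n j)) refl)))
  where
  t = toℕ j
  v = λ k → eval (X n k) y
  t<s : t < s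
  t<s = FP.toℕ<n j
  bnd : ∀ k → k ≤ s → k + r ≤ n
  bnd k h = NP.≤-trans (NP.+-monoˡ-≤ r h) (NP.≤-trans (NP.≤-reflexive (NP.+-comm s r)) hn)
  lhs : _ → eval (ariGArg n r i e (suc t)) (pointFrom (flatAt n) y) ≡ eval (ihGArg n r i (suc t)) y +q -q eval (ihGArg n r i t) y
  lhs (tri< a _ _) rewrite ariGArg-below n r i e (suc t) a | ihGArg-below n r i (suc t) a | ihGArg-below n r i t (NP.<⇒≤ a) =
    eval-X-flat n y (suc t) (NP.≤-trans (NP.≤-trans t<s (NP.m≤n+m s r)) hn)
  lhs (tri≈ _ refl _) rewrite ariGArg-merged n r t e | ihGArg-above n r t (suc t) NP.≤-refl | ihGArg-below n r t t NP.≤-refl | he =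
    trans (eval-flat-sumX n r t y (NP.≤-trans (NP.≤-reflexive (NP.+-suc t r)) (bnd (suc t) t<s)))
          (cong (λ k → v k -q v t) (NP.+-suc t r))
  lhs (tri> _ _ c) rewrite ariGArg-above n r i e (suc t) (s≤s c) | ihGArg-above n r i (suc t) (NP.<-trans c (NP.n<1+n t)) | ihGArg-above n r i t c =
    eval-X-flat n y (suc t + r) (bnd (suc t) t<s)

flat-ihFB : ∀ n r i (y : Point n) (j : Fin r) → i + r ≤ n →
  eval (flatσ r j) (pointFrom {r} (λ k → X n (i + r) ⊕ neg (X n (i + r ∸ k))) y)
  ≡ eval (X n (i + pos (opposite j))) (pointFrom (flatAt n) y)
flat-ihFB n r i y j h =
  begin
    eval (flatσ r j) (pointFrom {r} TB y)
  ≡⟨ cong₂ (λ p q → p +q -q q) (eval-X-pointFrom TB y (pos j) t<r (xmx (v (i + r)))) (eval-X-pointFrom TB y t (NP.<⇒≤ t<r) (xmx (v (i + r)))) ⟩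
    (v (i + r) -q v (i + r ∸ suc t)) +q -q (v (i + r) -q v (i + r ∸ t))
  ≡⟨ l (v (i + r)) (v (i + r ∸ suc t)) (v (i + r ∸ t)) ⟩
    v (i + r ∸ t) -q v (i + r ∸ suc t)
  ≡⟨ sym (cong₂ (λ p q → v p -q v q) e1 e2) ⟩
    v (i + pos o) -q v (i + pos o ∸ 1)
  ≡⟨ sym (eval-X-flat n y (i + pos o) b1) ⟩
    eval (X n (i + pos o)) (pointFrom (flatAt n) y)
  ∎
  where
  open ≡-Reasoning
  TB = λ k → X n (i + r) ⊕ neg (X n (i + r ∸ k))
  v = λ k → eval (X n k) y
  t = toℕ j
  o = opposite j
  t<r : t < r
  t<r = FP.toℕ<n j
  xmx : ∀ a → a +q -q a ≡ 0ℚ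
  xmx = solve-∀ ℚ-ring
  l : ∀ a b c → (a -q b) +q -q (a -q c) ≡ c -q b
  l = solve-∀ ℚ-ring
  op : toℕ o ≡ r ∸ suc t
  op = FP.opposite-prop j
  e2 : i + pos o ∸ 1 ≡ i + r ∸ suc t
  e2 = trans (cong (_∸ 1) (NP.+-suc i (toℕ o))) (trans (cong (i +_) op) (sym (NP.+-∸-assoc i t<r)))
  e1 : i + pos o ≡ i + r ∸ t
  e1 = trans (cong (λ z → i + suc z) op) (trans (cong (i +_) (sym (NP.+-∸-assoc 1 t<r))) (sym (NP.+-∸-assoc i (NP.<⇒≤ t<r))))
  b1 : i + pos o ≤ n
  b1 = NP.≤-trans (NP.+-monoʳ-≤ i (FP.toℕ<n o)) h

flat-ariA : ∀ n r s i (F : RatFun r) (G : RatFun s) → i ≤ s → r + s ≤ n →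
  Scaled 1ℚ (substR (flatσ n) (ariA n r s F G i)) (ihA n r s (substR (flatσ r) F) (substR (flatσ s) G) i)
flat-ariA n r s i F G hi hn =
  Scaled-* (Scaled-subst² (flatσ n) (λ j → X n (i + pos j)) (λ j → X n (i + pos j) ⊕ neg (X n i)) (flatσ r) F
           (λ y j → flat-ariF n r i y j (NP.≤-trans (NP.+-monoˡ-≤ r hi) (NP.≤-trans (NP.≤-reflexive (NP.+-comm s r)) hn))))
        (Scaled-subst² (flatσ n) (λ j → ariGArg n r i (i + r + 1) (pos j)) (λ j → ihGArg n r i (pos j)) (flatσ s) G
           (λ y j → flat-ariG n r s i (i + r + 1) y j hi hn (trans (NP.+-assoc i r 1) (cong (i +_) (NP.+-comm r 1)))))

-- Here ♭ yields the arguments of F in reverse order compared to the Ihara term,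
-- whence the sign −(−1)^r from φ-skewness.
flat-ariB : ∀ n r s i0 (F : RatFun r) (G : RatFun s) → φ-Skew F → i0 < s → r + s ≤ n →
  Scaled (-q sign r) (substR (flatσ n) (ariB n r s F G (suc i0))) (ihB n r s (substR (flatσ r) F) (substR (flatσ s) G) (suc i0))
flat-ariB n r s i0 F G skewF hi hn =
  Scaled-* (Scaled-subst²-reversed (flatσ n) (λ j → X n (suc i0 + pos j)) (λ j → X n (suc i0 + r) ⊕ neg (X n (suc i0 + r ∸ pos j))) (flatσ r) F skewF
           (λ y j → flat-ihFB n r (suc i0) y j hir))
        (Scaled-subst² (flatσ n) (λ j → ariGArg n r i0 (suc i0 + r) (pos j)) (λ j → ihGArg n r i0 (pos j)) (flatσ s) G
           (λ y j → flat-ariG n r s i0 (suc i0 + r) y j (NP.<⇒≤ hi) hn (sym (NP.+-suc i0 r))))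
  where
  hir : suc i0 + r ≤ n
  hir = NP.≤-trans (NP.+-monoˡ-≤ r hi) (NP.≤-trans (NP.≤-reflexive (NP.+-comm s r)) hn)

flat-ariTerm : ∀ n r s (F : RatFun r) (G : RatFun s) → φ-Skew F → r + s ≤ n →
  Scaled 1ℚ (substR (flatσ n) (ariTerm n r s F G)) (ihTerm n r s (substR (flatσ r) F) (substR (flatσ s) G))
flat-ariTerm n r s F G skewF hn =
  Scaled-+ (Scaled-≡ (cong (λ l → substR (flatσ n) (sumR l)) (sym (LP.map-upTo _ (suc s)))) (cong sumR (sym (LP.map-upTo _ (suc s))))
          (Scaled-substR-sum (flatσ n) (ariA n r s F G) (ihA n r s (substR (flatσ r) F) (substR (flatσ s) G)) (suc s)
             (λ i i<s → flat-ariA n r s i F G (NP.≤-pred i<s) hn)))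
        (Scaled-neg-sign r
          (Scaled-≡ (cong (λ l → substR (flatσ n) (sumR l)) (sym (map-from1 _ s))) (cong sumR (sym (map-from1 _ s)))
            (Scaled-substR-sum (flatσ n) (ariB n r s F G ∘ suc) (ihB n r s (substR (flatσ r) F) (substR (flatσ s) G) ∘ suc) s
               (λ i i<s → flat-ariB n r s i F G skewF i<s hn))))

flat-⊙ari : ∀ (f g : Seq) → (∀ r → φ-Skew (f r)) → ∀ n →
  Scaled 1ℚ (substR (flatσ n) ((f ⊙ari g) n)) ((flat f ⊙ flat g) n)
flat-⊙ari f g skewF n =
  Scaled-≡ (cong (λ l → substR (flatσ n) (sumR l)) (sym (LP.map-upTo _ (suc n)))) (cong sumR (sym (LP.map-upTo _ (suc n))))
    (Scaled-substR-sum (flatσ n) (λ r → ariTerm n r (n ∸ r) (f r) (g (n ∸ r))) (λ r → ihTerm n r (n ∸ r) (flat f r) (flat g (n ∸ r))) (suc n)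
      (λ r r<n → flat-ariTerm n r (n ∸ r) (f r) (g (n ∸ r)) (skewF r) (NP.≤-reflexive (NP.m+[n∸m]≡n (NP.≤-pred r<n)))))

flat-ari : ∀ (f g : Seq) → (∀ r → φ-Skew (f r)) → (∀ r → φ-Skew (g r)) → flat (ari f g) ≈S ihara (flat f) (flat g)
flat-ari f g skewF skewG n = Scaled⇒≈R (Scaled-+ (flat-⊙ari f g skewF n) (Scaled-neg (flat-⊙ari g f skewG n)))

-- ♭ is injective

module _ {r : ℕ} (y : Point r) where

  partialSum : ℕ → ℚ
  partialSum zero    = 0ℚ
  partialSum (suc k) = partialSum k +q eval (X r (suc k)) y

  unflat : Point r
  unflat j = partialSum (pos j)

  eval-X-unflat : ∀ k → k ≤ r → eval (X r k) unflat ≡ partialSum k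
  eval-X-unflat zero    h = refl
  eval-X-unflat (suc k) h = trans (eval-X r k unflat h) (cong (λ t → partialSum (suc t)) (FP.toℕ-fromℕ< h))

  eval-flatσ-unflat : ∀ j → eval (flatσ r j) unflat ≡ y j
  eval-flatσ-unflat j =
    begin
      eval (flatσ r j) unflat
    ≡⟨ cong₂ (λ a b → a +q -q b) (eval-X-unflat (pos j) j<r) (eval-X-unflat (toℕ j) (NP.<⇒≤ j<r)) ⟩
      (partialSum (toℕ j) +q eval (X r (pos j)) y) +q -q partialSum (toℕ j)
    ≡⟨ l (partialSum (toℕ j)) (eval (X r (pos j)) y) ⟩
      eval (X r (pos j)) y
    ≡⟨ eval-X r (toℕ j) y j<r ⟩
      y (fromℕ< j<r)
    ≡⟨ cong y (FP.fromℕ<-toℕ j j<r) ⟩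
      y j
    ∎
    where
    open ≡-Reasoning
    j<r = FP.toℕ<n j
    l : ∀ a b → (a +q b) +q -q a ≡ b
    l = solve-∀ ℚ-ring

  eval-flat-unflat : ∀ (p : Poly r) → eval (substP (flatσ r) p) unflat ≡ eval p y
  eval-flat-unflat p = trans (eval-subst (flatσ r) p unflat) (eval-cong p eval-flatσ-unflat)

flat-injective : ∀ (f g : Seq) → flat f ≈S flat g → f ≈S g
flat-injective f g h r y =
  begin
    eval (num (f r)) y *q eval (den (g r)) y
  ≡⟨ sym (cong₂ _*q_ (eval-flat-unflat y (num (f r))) (eval-flat-unflat y (den (g r)))) ⟩
    eval (num (flat f r) ⊗ den (flat g r)) (unflat y)
  ≡⟨ h r (unflat y) ⟩
    eval (num (flat g r) ⊗ den (flat f r)) (unflat y)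
  ≡⟨ cong₂ _*q_ (eval-flat-unflat y (num (g r))) (eval-flat-unflat y (den (f r))) ⟩
    eval (num (g r)) y *q eval (den (f r)) y
  ∎
  where open ≡-Reasoning

-- Values of rational functions

-- 1/0 is taken to be 0; values are only used where the denominator is nonzero.
inv0 : ℚ → ℚ
inv0 a with a Q.≟ 0ℚ
... | yes _ = 0ℚ
... | no h = Q.1/_ a {{Q.≢-nonZero h}}

*-inv0 : ∀ a → a ≢ 0ℚ → a *q inv0 a ≡ 1ℚ
*-inv0 a h with a Q.≟ 0ℚ
... | yes e = ⊥-elim (h e)
... | no h' = QP.*-inverseʳ a {{Q.≢-nonZero h'}}

inv0-unique : ∀ c v → c ≢ 0ℚ → v *q c ≡ 1ℚ → inv0 c ≡ v
inv0-unique c v hc e = trans (sym (QP.*-identityˡ (inv0 c))) (trans (cong (_*q inv0 c) (sym e)) (trans (QP.*-assoc v c (inv0 c)) (trans (cong (v *q_) (*-inv0 c hc)) (QP.*-identityʳ v))))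

inv0-1 : inv0 1ℚ ≡ 1ℚ
inv0-1 = inv0-unique 1ℚ 1ℚ (λ ()) refl

value : ∀ {r} → RatFun r → Point r → ℚ
value p x = eval (num p) x *q inv0 (eval (den p) x)

Defined : ∀ {r} → RatFun r → Point r → Set
Defined p x = eval (den p) x ≢ 0ℚ

value-unique : ∀ a b v → b ≢ 0ℚ → a ≡ v *q b → a *q inv0 b ≡ v
value-unique a b v hb e = trans (cong (_*q inv0 b) e) (trans (QP.*-assoc v b (inv0 b)) (trans (cong (v *q_) (*-inv0 b hb)) (QP.*-identityʳ v)))

num≡value*den : ∀ {r} (p : RatFun r) x → Defined p x → eval (num p) x ≡ value p x *q eval (den p) x
num≡value*den p x g = sym (trans (QP.*-assoc a (inv0 b) b) (trans (cong (a *q_) (trans (QP.*-comm (inv0 b) b) (*-inv0 b g))) (QP.*-identityʳ a)))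
  where
  a = eval (num p) x
  b = eval (den p) x

Defined-+ : ∀ {r} (p q : RatFun r) x → Defined (p +R q) x → Defined p x × Defined q x
Defined-+ p q x g = *≢0⇒≢0 (eval (den p) x) (eval (den q) x) g

Defined-* : ∀ {r} (p q : RatFun r) x → Defined (p *R q) x → Defined p x × Defined q x
Defined-* p q x g = *≢0⇒≢0 (eval (den p) x) (eval (den q) x) g

value-+ : ∀ {r} (p q : RatFun r) x → Defined (p +R q) x → value (p +R q) x ≡ value p x +q value q x
value-+ p q x g = value-unique _ _ _ g
  (trans (cong₂ (λ u v → u *q eval (den q) x +q v *q eval (den p) x) (num≡value*den p x gp) (num≡value*den q x gq))
         (l (value p x) (value q x) (eval (den p) x) (eval (den q) x)))
  where
  gp = proj₁ (Defined-+ p q x g)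
  gq = proj₂ (Defined-+ p q x g)
  l : ∀ u v b d → (u *q b) *q d +q (v *q d) *q b ≡ (u +q v) *q (b *q d)
  l = solve-∀ ℚ-ring

value-* : ∀ {r} (p q : RatFun r) x → Defined (p *R q) x → value (p *R q) x ≡ value p x *q value q x
value-* p q x g = value-unique _ _ _ g
  (trans (cong₂ _*q_ (num≡value*den p x gp) (num≡value*den q x gq))
         (l (value p x) (value q x) (eval (den p) x) (eval (den q) x)))
  where
  gp = proj₁ (Defined-* p q x g)
  gq = proj₂ (Defined-* p q x g)
  l : ∀ u v b d → (u *q b) *q (v *q d) ≡ (u *q v) *q (b *q d)
  l = solve-∀ ℚ-ring

value-neg : ∀ {r} (p : RatFun r) x → value (negR p) x ≡ -q value p x
value-neg p x = l (eval (num p) x) (inv0 (eval (den p) x))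
  where
  l : ∀ a b → (-q a) *q b ≡ -q (a *q b)
  l = solve-∀ ℚ-ring

value-zero : ∀ {r} x → value {r} zeroR x ≡ 0ℚ
value-zero x = QP.*-zeroˡ (inv0 1ℚ)

value-subst : ∀ {r n} (σ : Fin r → Poly n) (p : RatFun r) x → value (substR σ p) x ≡ value p (λ i → eval (σ i) x)
value-subst σ p x = cong₂ (λ a b → a *q inv0 b) (eval-subst σ (num p) x) (eval-subst σ (den p) x)

Defined-subst : ∀ {r n} (σ : Fin r → Poly n) (p : RatFun r) x → Defined (substR σ p) x → Defined p (λ i → eval (σ i) x)
Defined-subst σ p x g e = g (trans (eval-subst σ (den p) x) e)

Defined-subst⁻ : ∀ {r n} (σ : Fin r → Poly n) (p : RatFun r) x → Defined p (λ i → eval (σ i) x) → Defined (substR σ p) x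
Defined-subst⁻ σ p x g e = g (trans (sym (eval-subst σ (den p) x)) e)

value-cong : ∀ {r} (p : RatFun r) {x y : Point r} → (∀ i → x i ≡ y i) → value p x ≡ value p y
value-cong p h = cong₂ (λ a b → a *q inv0 b) (eval-cong (num p) h) (eval-cong (den p) h)

Defined-cong : ∀ {r} (p : RatFun r) {x y : Point r} → (∀ i → x i ≡ y i) → Defined p x → Defined p y
Defined-cong p h g e = g (trans (eval-cong (den p) h) e)

value-sign : ∀ {r} k (p : RatFun r) x → value (signR k p) x ≡ sign k *q value p x
value-sign k p x rewrite den-signR k p | eval-num-signR k p x = QP.*-assoc (sign k) (eval (num p) x) (inv0 (eval (den p) x))

≈R⇒value≡ : ∀ {r} {p q : RatFun r} → p ≈R q → ∀ x → Defined p x → Defined q x → value p x ≡ value q x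
≈R⇒value≡ {p = p} {q} h x gp gq = value-unique _ _ _ gp (cancel)
  where
  cancel0 : eval (num p) x +q -q (value q x *q eval (den p) x) ≡ 0ℚ
  cancel0 = *≡0⇒≡0ʳ (eval (den q) x) _ (trans (l (eval (den q) x) (eval (num p) x) (value q x) (eval (den p) x))
             (trans (cong (λ z → eval (num p) x *q eval (den q) x +q -q (z *q eval (den p) x)) (QP.*-comm (eval (den q) x) (value q x)))
               (trans (cong (λ z → eval (num p) x *q eval (den q) x +q -q (z *q eval (den p) x)) (sym (num≡value*den q x gq)))
                 (trans (cong (λ z → z +q -q (eval (num q) x *q eval (den p) x)) (h x)) (QP.+-inverseʳ (eval (num q) x *q eval (den p) x)))))) gq
    where
    l : ∀ d a v b → d *q (a +q -q (v *q b)) ≡ a *q d +q -q ((d *q v) *q b)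
    l = solve-∀ ℚ-ring

  cancel : eval (num p) x ≡ value q x *q eval (den p) x
  cancel = trans (sym (lz _ _)) (trans (cong (_+q (value q x *q eval (den p) x)) cancel0) (QP.+-identityˡ _))
    where
    lz : ∀ a c → (a +q -q c) +q c ≡ a
    lz = solve-∀ ℚ-ring

value≡⇒cross : ∀ {r} {p q : RatFun r} x → Defined p x → Defined q x → value p x ≡ value q x →
  eval (num p) x *q eval (den q) x ≡ eval (num q) x *q eval (den p) x
value≡⇒cross {p = p} {q} x gp gq e =
  trans (cong (_*q eval (den q) x) (num≡value*den p x gp))
    (trans (cong (λ z → (z *q eval (den p) x) *q eval (den q) x) e)
      (trans (l (value q x) (eval (den p) x) (eval (den q) x)) (cong (_*q eval (den p) x) (sym (num≡value*den q x gq)))))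
  where
  l : ∀ v b d → (v *q b) *q d ≡ (v *q d) *q b
  l = solve-∀ ℚ-ring

≈R-from-values : ∀ {r} {p q : RatFun r} (D : Poly r) → NonZeroP D →
  (∀ x → eval D x ≢ 0ℚ → eval (num p) x *q eval (den q) x ≡ eval (num q) x *q eval (den p) x) → p ≈R q
≈R-from-values {p = p} {q} D nz H x = trans (sym (l2 (eval (num p ⊗ den q) x) (eval (num q ⊗ den p) x)))
  (trans (cong (_+q eval (num q ⊗ den p) x) (vanishing-cancelʳ E D ED nz x)) (QP.+-identityˡ (eval (num q ⊗ den p) x)))
  where
  E = num p ⊗ den q ⊕ neg (num q ⊗ den p)
  l2 : ∀ a b → (a +q -q b) +q b ≡ a
  l2 = solve-∀ ℚ-ring
  ED : ∀ x → eval E x *q eval D x ≡ 0ℚ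
  ED x with eval D x Q.≟ 0ℚ
  ... | yes e = trans (cong (eval E x *q_) e) (QP.*-zeroʳ (eval E x))
  ... | no ne = trans (cong (_*q eval D x) (trans (cong (_+q -q (eval (num q ⊗ den p) x)) (H x ne)) (QP.+-inverseʳ (eval (num q ⊗ den p) x)))) (QP.*-zeroˡ (eval D x))

≈R-from-value≡ : ∀ {r} {p q : RatFun r} (D : Poly r) → NonZeroP ((den p ⊗ den q) ⊗ D) →
  (∀ x → Defined p x → Defined q x → eval D x ≢ 0ℚ → value p x ≡ value q x) → p ≈R q
≈R-from-value≡ {p = p} {q} D nz H = ≈R-from-values {p = p} {q} ((den p ⊗ den q) ⊗ D) nz λ x ne →
  let (dpq , dD) = *≢0⇒≢0 (eval (den p ⊗ den q) x) (eval D x) ne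
      (dp , dq) = *≢0⇒≢0 (eval (den p) x) (eval (den q) x) dpq
  in value≡⇒cross {p = p} {q} x dp dq (H x dp dq dD)

φ-SkewValues : ∀ {r} → RatFun r → Set
φ-SkewValues {r} F = ∀ (u u' : Point r) → (∀ j → u' j ≡ u (opposite j)) → Defined F u → Defined F u' → value F u ≡ (-q sign r) *q value F u'

φ-skew-values : ∀ {r} (F : RatFun r) → φ-Skew F → φ-SkewValues F
φ-skew-values {r} F skewF u u' h gu gu' = value-unique (eval (num F) u) (eval (den F) u) _ gu nu
  where
  uo = λ j → u (opposite j)
  a = eval (num F) u ; b = eval (den F) u ; c = eval (num F) uo ; d = eval (den F) uo
  e1 : eval (den F) u' ≡ d
  e1 = eval-cong (den F) h
  e2 : eval (num F) u' ≡ c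
  e2 = eval-cong (num F) h
  gd : d ≢ 0ℚ
  gd e = gu' (trans e1 e)
  vu' : c ≡ value F u' *q d
  vu' = trans (sym e2) (trans (num≡value*den F u' gu') (cong (value F u' *q_) e1))
  key : d *q (a +q -q ((-q sign r) *q value F u' *q b)) ≡ 0ℚ
  key = trans (l (sign r) a b d (value F u')) (trans (cong (λ z → a *q d +q sign r *q (z *q b)) (sym vu')) (skewF u))
    where
    l : ∀ s a b d v → d *q (a +q -q ((-q s) *q v *q b)) ≡ a *q d +q s *q ((v *q d) *q b)
    l = solve-∀ ℚ-ring
  nu : a ≡ (-q sign r) *q value F u' *q b
  nu = trans (sym (lz a _)) (trans (cong (_+q ((-q sign r) *q value F u' *q b)) (*≡0⇒≡0ʳ d _ key gd)) (QP.+-identityˡ _))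
    where
    lz : ∀ a c → (a +q -q c) +q c ≡ a
    lz = solve-∀ ℚ-ring

fArg : ∀ n r → ℕ → Point n → Point r
fArg n r i x j = eval (X n (i ℕ.+ pos j)) x

gArgA : ∀ n r s → ℕ → Point n → Point s
gArgA n r s i x j = eval (if pos j ≤ᵇ i then X n (pos j)
                else if pos j ≤ᵇ suc i then sumX n (suc i) (i ℕ.+ r ℕ.+ 1)
                else X n (pos j ℕ.+ r)) x

gArgB : ∀ n r s → ℕ → Point n → Point s
gArgB n r s i x j = eval (if pos j ≤ᵇ (i ∸ 1) then X n (pos j)
                else if pos j ≤ᵇ i then sumX n i (i ℕ.+ r)
                else X n (pos j ℕ.+ r)) x

Values : Set
Values = (r : ℕ) → Point r → ℚ

ariTermV : ∀ n r s → (Point r → ℚ) → (Point s → ℚ) → Point n → ℚ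
ariTermV n r s vF vG x = ∑< (suc s) (λ i → vF (fArg n r i x) *q vG (gArgA n r s i x)) -q ∑< s (λ i → vF (fArg n r (suc i) x) *q vG (gArgB n r s (suc i) x))

⊙ariV : Values → Values → (n : ℕ) → Point n → ℚ
⊙ariV vf vg n x = ∑< (suc n) (λ r → ariTermV n r (n ∸ r) (vf r) (vg (n ∸ r)) x)

ariV : Values → Values → (n : ℕ) → Point n → ℚ
ariV vf vg n x = ⊙ariV vf vg n x -q ⊙ariV vg vf n x

PointPred : Set₁
PointPred = (r : ℕ) → Point r → Set

PointCong : Values → Set
PointCong vf = ∀ r {u u' : Point r} → (∀ j → u j ≡ u' j) → vf r u ≡ vf r u'

values : Seq → Values
values f r = value (f r)

values-cong : ∀ f → PointCong (values f)
values-cong f r h = value-cong (f r) h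

DefinedP : Seq → PointPred
DefinedP f r u = Defined (f r) u

DefinedP-cong : ∀ f r {u u' : Point r} → (∀ j → u j ≡ u' j) → DefinedP f r u → DefinedP f r u'
DefinedP-cong f r h g = Defined-cong (f r) h g

AtTermArgs : ∀ n r s → (Point r → Set) → (Point s → Set) → Point n → Set
AtTermArgs n r s P Q x = (∀ i → i < suc s → P (fArg n r i x) × Q (gArgA n r s i x)) × (∀ i → i < s → P (fArg n r (suc i) x) × Q (gArgB n r s (suc i) x))

AtArgs : PointPred → PointPred → (n : ℕ) → Point n → Set
AtArgs P Q n x = ∀ r → r < suc n → AtTermArgs n r (n ∸ r) (P r) (Q (n ∸ r)) x

AtArgs-map : ∀ {P Q P' Q' : PointPred} → (∀ r u → P r u → P' r u) → (∀ r u → Q r u → Q' r u) → ∀ {n x} → AtArgs P Q n x → AtArgs P' Q' n x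
AtArgs-map hp hq U r r< = (λ i i< → hp _ _ (proj₁ (proj₁ (U r r<) i i<)) , hq _ _ (proj₂ (proj₁ (U r r<) i i<)))
                       , (λ i i< → hp _ _ (proj₁ (proj₂ (U r r<) i i<)) , hq _ _ (proj₂ (proj₂ (U r r<) i i<)))

AtArgs-zip : ∀ {P Q P' Q' : PointPred} {n x} → AtArgs P Q n x → AtArgs P' Q' n x → AtArgs (λ r u → P r u × P' r u) (λ r u → Q r u × Q' r u) n x
AtArgs-zip U U' r r< = (λ i i< → (proj₁ (proj₁ (U r r<) i i<) , proj₁ (proj₁ (U' r r<) i i<)) , (proj₂ (proj₁ (U r r<) i i<) , proj₂ (proj₁ (U' r r<) i i<)))
                    , (λ i i< → (proj₁ (proj₂ (U r r<) i i<) , proj₁ (proj₂ (U' r r<) i i<)) , (proj₂ (proj₂ (U r r<) i i<) , proj₂ (proj₂ (U' r r<) i i<)))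

Defined-sum : ∀ {n} (h : ℕ → RatFun n) m x → Defined (sumR (applyUpTo h m)) x → ∀ i → i < m → Defined (h i) x
Defined-sum h (suc m) x g zero _ = proj₁ (Defined-+ (h 0) (sumR (applyUpTo (h ∘ suc) m)) x g)
Defined-sum h (suc m) x g (suc i) (s≤s i<m) = Defined-sum (h ∘ suc) m x (proj₂ (Defined-+ (h 0) (sumR (applyUpTo (h ∘ suc) m)) x g)) i i<m

value-sum : ∀ {n} (h : ℕ → RatFun n) (v : ℕ → ℚ) m x → Defined (sumR (applyUpTo h m)) x →
  (∀ i → i < m → Defined (h i) x → value (h i) x ≡ v i) → value (sumR (applyUpTo h m)) x ≡ ∑< m v
value-sum h v zero x g H = value-zero x
value-sum h v (suc m) x g H =
  trans (value-+ (h 0) (sumR (applyUpTo (h ∘ suc) m)) x g)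
        (cong₂ _+q_ (H 0 (s≤s z≤n) (proj₁ (Defined-+ (h 0) (sumR (applyUpTo (h ∘ suc) m)) x g)))
                    (value-sum (h ∘ suc) (v ∘ suc) m x (proj₂ (Defined-+ (h 0) (sumR (applyUpTo (h ∘ suc) m)) x g)) (λ i i<m → H (suc i) (s≤s i<m))))

module _ (n r s : ℕ) (F : RatFun r) (G : RatFun s) (x : Point n) where
  private
    SA SB : RatFun n
    SA = sumR (map (ariA n r s F G) (from0 s))
    SB = sumR (map (ariB n r s F G) (from1 s))

    eqA : SA ≡ sumR (applyUpTo (ariA n r s F G) (suc s))
    eqA = cong sumR (LP.map-upTo (ariA n r s F G) (suc s))

    eqB : SB ≡ sumR (applyUpTo (ariB n r s F G ∘ suc) s)
    eqB = cong sumR (map-from1 (ariB n r s F G) s)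

    τF : ℕ → Fin r → Poly n
    τF i j = X n (i ℕ.+ pos j)
    τA : ℕ → Fin s → Poly n
    τA i j = if pos j ≤ᵇ i then X n (pos j)
                  else if pos j ≤ᵇ suc i then sumX n (suc i) (i ℕ.+ r ℕ.+ 1)
                  else X n (pos j ℕ.+ r)
    τB : ℕ → Fin s → Poly n
    τB i j = if pos j ≤ᵇ (i ∸ 1) then X n (pos j)
                  else if pos j ≤ᵇ i then sumX n i (i ℕ.+ r)
                  else X n (pos j ℕ.+ r)

    Defined-ariA : ∀ i → Defined (ariA n r s F G i) x → Defined F (fArg n r i x) × Defined G (gArgA n r s i x)
    Defined-ariA i g = Defined-subst (τF i) F x (proj₁ (Defined-* (substR (τF i) F) (substR (τA i) G) x g))
                     , Defined-subst (τA i) G x (proj₂ (Defined-* (substR (τF i) F) (substR (τA i) G) x g))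

    Defined-ariB : ∀ i → Defined (ariB n r s F G i) x → Defined F (fArg n r i x) × Defined G (gArgB n r s i x)
    Defined-ariB i g = Defined-subst (τF i) F x (proj₁ (Defined-* (substR (τF i) F) (substR (τB i) G) x g))
                     , Defined-subst (τB i) G x (proj₂ (Defined-* (substR (τF i) F) (substR (τB i) G) x g))

  Defined⇒AtTermArgs : Defined (ariTerm n r s F G) x → AtTermArgs n r s (Defined F) (Defined G) x
  Defined⇒AtTermArgs g = (λ i i< → Defined-ariA i (Defined-sum (ariA n r s F G) (suc s) x (subst (λ z → Defined z x) eqA (proj₁ (Defined-+ SA (negR SB) x g))) i i<))
             , (λ i i< → Defined-ariB (suc i) (Defined-sum (ariB n r s F G ∘ suc) s x (subst (λ z → Defined z x) eqB (proj₂ (Defined-+ SA (negR SB) x g))) i i<))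

  value-ariTerm : Defined (ariTerm n r s F G) x → value (ariTerm n r s F G) x ≡ ariTermV n r s (value F) (value G) x
  value-ariTerm g =
    trans (value-+ SA (negR SB) x g)
      (cong₂ _+q_
        (trans (cong (λ z → value z x) eqA)
          (value-sum (ariA n r s F G) (λ i → value F (fArg n r i x) *q value G (gArgA n r s i x)) (suc s) x (subst (λ z → Defined z x) eqA gA)
            (λ i i< gi → trans (value-* (substR (τF i) F) (substR (τA i) G) x gi) (cong₂ _*q_ (value-subst (τF i) F x) (value-subst (τA i) G x)))))
        (trans (value-neg SB x) (cong -q_
          (trans (cong (λ z → value z x) eqB)
            (value-sum (ariB n r s F G ∘ suc) (λ i → value F (fArg n r (suc i) x) *q value G (gArgB n r s (suc i) x)) s x (subst (λ z → Defined z x) eqB gB)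
              (λ i i< gi → trans (value-* (substR (τF (suc i)) F) (substR (τB (suc i)) G) x gi) (cong₂ _*q_ (value-subst (τF (suc i)) F x) (value-subst (τB (suc i)) G x))))))))
    where
    gA = proj₁ (Defined-+ SA (negR SB) x g)
    gB = proj₂ (Defined-+ SA (negR SB) x g)

module _ (f g : Seq) (n : ℕ) (x : Point n) where
  private
    OD : RatFun n
    OD = (f ⊙ari g) n

    eqO : OD ≡ sumR (applyUpTo (λ r → ariTerm n r (n ∸ r) (f r) (g (n ∸ r))) (suc n))
    eqO = cong sumR (LP.map-upTo (λ r → ariTerm n r (n ∸ r) (f r) (g (n ∸ r))) (suc n))

  Defined⇒AtArgs : Defined OD x → AtArgs (λ r u → Defined (f r) u) (λ s w → Defined (g s) w) n x
  Defined⇒AtArgs gd r r< = Defined⇒AtTermArgs n r (n ∸ r) (f r) (g (n ∸ r)) x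
    (Defined-sum (λ r → ariTerm n r (n ∸ r) (f r) (g (n ∸ r))) (suc n) x (subst (λ z → Defined z x) eqO gd) r r<)

  value-⊙ari : Defined OD x → value OD x ≡ ⊙ariV (values f) (values g) n x
  value-⊙ari gd = trans (cong (λ z → value z x) eqO)
    (value-sum (λ r → ariTerm n r (n ∸ r) (f r) (g (n ∸ r))) (λ r → ariTermV n r (n ∸ r) (value (f r)) (value (g (n ∸ r))) x)
               (suc n) x (subst (λ z → Defined z x) eqO gd) (λ r r< gr → value-ariTerm n r (n ∸ r) (f r) (g (n ∸ r)) x gr))

value-ari : ∀ f g n x → Defined (ari f g n) x → value (ari f g n) x ≡ ariV (values f) (values g) n x
value-ari f g n x gd = trans (value-+ ((f ⊙ari g) n) (negR ((g ⊙ari f) n)) x gd)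
  (cong₂ _+q_ (value-⊙ari f g n x (proj₁ (Defined-+ ((f ⊙ari g) n) (negR ((g ⊙ari f) n)) x gd)))
              (trans (value-neg ((g ⊙ari f) n) x) (cong -q_ (value-⊙ari g f n x (proj₂ (Defined-+ ((f ⊙ari g) n) (negR ((g ⊙ari f) n)) x gd))))))

Defined⇒AtArgs-ari : ∀ f g n x → Defined (ari f g n) x → AtArgs (DefinedP f) (DefinedP g) n x × AtArgs (DefinedP g) (DefinedP f) n x
Defined⇒AtArgs-ari f g n x gd = Defined⇒AtArgs f g n x (proj₁ (Defined-+ ((f ⊙ari g) n) (negR ((g ⊙ari f) n)) x gd))
                   , Defined⇒AtArgs g f n x (proj₂ (Defined-+ ((f ⊙ari g) n) (negR ((g ⊙ari f) n)) x gd))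

⊙ariV-cong : ∀ (vf vg vf' vg' : Values) n x → AtArgs (λ r u → vf r u ≡ vf' r u) (λ s w → vg s w ≡ vg' s w) n x →
  ⊙ariV vf vg n x ≡ ⊙ariV vf' vg' n x
⊙ariV-cong vf vg vf' vg' n x U = ∑<-cong (suc n) _ _ λ r r< →
  cong₂ _-q_ (∑<-cong (suc (n ∸ r)) _ _ (λ i i< → cong₂ _*q_ (proj₁ (proj₁ (U r r<) i i<)) (proj₂ (proj₁ (U r r<) i i<))))
             (∑<-cong (n ∸ r) _ _ (λ i i< → cong₂ _*q_ (proj₁ (proj₂ (U r r<) i i<)) (proj₂ (proj₂ (U r r<) i i<))))

ariV-cong : ∀ (vf vg vf' vg' : Values) n x →
  AtArgs (λ r u → vf r u ≡ vf' r u) (λ s w → vg s w ≡ vg' s w) n x →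
  AtArgs (λ r u → vg r u ≡ vg' r u) (λ s w → vf s w ≡ vf' s w) n x →
  ariV vf vg n x ≡ ariV vf' vg' n x
ariV-cong vf vg vf' vg' n x U1 U2 = cong₂ _-q_ (⊙ariV-cong vf vg vf' vg' n x U1) (⊙ariV-cong vg vf vg' vf' n x U2)

value-≈S : ∀ (f f' : Seq) → f ≈S f' → ∀ r u → DefinedP f r u × DefinedP f' r u → value (f r) u ≡ value (f' r) u
value-≈S f f' e r u (g , g') = ≈R⇒value≡ {p = f r} {q = f' r} (e r) u g g'

pointOfSeq : ∀ {n} → (ℕ → ℚ) → Point n
pointOfSeq w j = w (suc (toℕ j))

eval-X-pointOfSeq : ∀ n (w : ℕ → ℚ) → w 0 ≡ 0ℚ → ∀ k → k ≤ n → eval (X n k) (pointOfSeq {n} w) ≡ w k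
eval-X-pointOfSeq n w w0 k h = eval-X-pointFrom {n} {n} (λ k → con (w k)) (λ _ → 0ℚ) k h w0

coords : ∀ {s} → Point s → ℕ → ℚ
coords {s} y k = eval (X s k) y

coords-pos : ∀ {s} (y : Point s) (j : Fin s) → coords y (suc (toℕ j)) ≡ y j
coords-pos {s} y j = trans (eval-X s (toℕ j) y (FP.toℕ<n j)) (cong y (FP.fromℕ<-toℕ j (FP.toℕ<n j)))

surjective-fArg : ∀ n r i → i + r ≤ n → Surjective {r} {n} (λ j → X n (i + pos j))
surjective-fArg n r i h y = pointOfSeq w , λ j → trans (eval-X-pointOfSeq n w refl (i + pos j) (bj j)) (trans (wj j) (coords-pos y j))
  where
  w : ℕ → ℚ
  w k = if k ≤ᵇ i then 0ℚ else coords y (k ∸ i)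
  bj : ∀ (j : Fin r) → i + pos j ≤ n
  bj j = NP.≤-trans (NP.+-monoʳ-≤ i (FP.toℕ<n j)) h
  wj : ∀ (j : Fin r) → w (i + pos j) ≡ coords y (pos j)
  wj j rewrite >⇒≤ᵇ≡false {i + pos j} {i} (NP.≤-trans (s≤s (NP.m≤m+n i (toℕ j))) (NP.≤-reflexive (sym (NP.+-suc i (toℕ j)))))
    = cong (coords y) (NP.m+n∸m≡n i (pos j))

surjective-gArgA : ∀ n r s i e → i ≤ s → r + s ≤ n → e ≡ i + suc r → Surjective {s} {n} (λ j → ariGArg n r i e (pos j))
surjective-gArgA n r s i e hi hn he y = pointOfSeq w , λ j → trans (cas j (NP.<-cmp (toℕ j) i)) (coords-pos y j)
  where
  w : ℕ → ℚ
  w k = if k ≤ᵇ suc i then coords y k else if k ≤ᵇ suc i + r then 0ℚ else coords y (k ∸ r)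
  w0 : w 0 ≡ 0ℚ
  w0 = refl
  wlo : ∀ k → k ≤ suc i → w k ≡ coords y k
  wlo k h rewrite ≤⇒≤ᵇ≡true h = refl
  bnd : ∀ k → k ≤ s → k + r ≤ n
  bnd k h = NP.≤-trans (NP.+-monoˡ-≤ r h) (NP.≤-trans (NP.≤-reflexive (NP.+-comm s r)) hn)
  cas : ∀ (j : Fin s) → _ → eval (ariGArg n r i e (pos j)) (pointOfSeq w) ≡ coords y (pos j)
  cas j (tri< a _ _) rewrite ariGArg-below n r i e (pos j) a =
    trans (eval-X-pointOfSeq n w w0 (pos j) (NP.≤-trans (NP.≤-trans (FP.toℕ<n j) (NP.m≤n+m s r)) hn))
          (wlo (pos j) (NP.≤-trans a (NP.n≤1+n i)))
  cas j (tri≈ _ refl _) rewrite ariGArg-merged n r (toℕ j) e | he =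
    trans (eval-sumX n (suc t) (t + suc r) (pointOfSeq w))
      (trans (cong (λ m → ∑< m (λ l → eval (X n (suc t + l)) (pointOfSeq w))) (NP.m+n∸m≡n t (suc r)))
        (trans (∑<-cong (suc r) _ (λ l → w (suc t + l)) (λ l l< → eval-X-pointOfSeq n w w0 (suc t + l)
                  (NP.≤-trans (NP.≤-trans (NP.≤-reflexive (sym (NP.+-suc t l))) (NP.+-monoʳ-≤ t l<))
                              (NP.≤-trans (NP.≤-reflexive (NP.+-suc t r)) (bnd (suc t) (FP.toℕ<n j))))))
          (trans (cong₂ _+q_ w1 (∑<-zero r _ (λ l l< → wz l l<))) (QP.+-identityʳ _))))
    where
    t = toℕ j
    w1 : w (suc t + 0) ≡ coords y (suc t)
    w1 rewrite NP.+-identityʳ t | ≤⇒≤ᵇ≡true {suc t} {suc t} NP.≤-refl = refl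
    wz : ∀ l → l < r → w (suc t + suc l) ≡ 0ℚ
    wz l l< rewrite >⇒≤ᵇ≡false {suc t + suc l} {suc t} (NP.≤-trans (s≤s (s≤s (NP.m≤m+n t l))) (NP.≤-reflexive (cong suc (sym (NP.+-suc t l)))))
                  | ≤⇒≤ᵇ≡true {suc t + suc l} {suc t + r} (NP.+-monoʳ-≤ (suc t) l<) = refl
  cas j (tri> _ _ c) rewrite ariGArg-above n r i e (pos j) (s≤s c) =
    trans (eval-X-pointOfSeq n w w0 (pos j + r) (bnd (pos j) (FP.toℕ<n j)))
      (trans (cong₂ (λ b b' → if b then coords y (pos j + r) else if b' then 0ℚ else coords y (pos j + r ∸ r))
                    (>⇒≤ᵇ≡false {pos j + r} {suc i} (NP.≤-trans (s≤s c) (NP.m≤m+n (pos j) r)))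
                    (>⇒≤ᵇ≡false {pos j + r} {suc i + r} (NP.+-monoˡ-< r (s≤s c))))
             (cong (coords y) (NP.m+n∸n≡m (pos j) r)))

NonZeroP-den-ariTerm : ∀ n r s (F : RatFun r) (G : RatFun s) → NonZeroP (den F) → NonZeroP (den G) → r + s ≤ n →
  NonZeroP (den (ariTerm n r s F G))
NonZeroP-den-ariTerm n r s F G nF nG hn =
  NonZeroP-⊗ (den (sumR (map (ariA n r s F G) (from0 s)))) (den (sumR (map (ariB n r s F G) (from1 s))))
    (NonZeroP-den-≡ (sym (cong sumR (LP.map-upTo (ariA n r s F G) (suc s))))
      (NonZeroP-den-sum (ariA n r s F G) (suc s) λ i i< → termA i (NP.≤-pred i<)))
    (NonZeroP-den-≡ (sym (cong sumR (map-from1 (ariB n r s F G) s)))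
      (NonZeroP-den-sum (ariB n r s F G ∘ suc) s termB))
  where
  hir : ∀ i → i ≤ s → i + r ≤ n
  hir i h = NP.≤-trans (NP.+-monoˡ-≤ r h) (NP.≤-trans (NP.≤-reflexive (NP.+-comm s r)) hn)
  termA : ∀ i → i ≤ s → NonZeroP (den (ariA n r s F G i))
  termA i i≤s = NonZeroP-⊗ (substP σ (den F)) (substP τ (den G))
    (NonZeroP-subst σ (surjective-fArg n r i (hir i i≤s)) (den F) nF)
    (NonZeroP-subst τ (surjective-gArgA n r s i (i + r + 1) i≤s hn (trans (NP.+-assoc i r 1) (cong (i +_) (NP.+-comm r 1)))) (den G) nG)
    where
    σ : Fin r → Poly n
    σ j = X n (i + pos j)
    τ : Fin s → Poly n
    τ j = ariGArg n r i (i + r + 1) (pos j)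
  termB : ∀ i → i < s → NonZeroP (den (ariB n r s F G (suc i)))
  termB i i<s = NonZeroP-⊗ (substP σ (den F)) (substP τ (den G))
    (NonZeroP-subst σ (surjective-fArg n r (suc i) (hir (suc i) i<s)) (den F) nF)
    (NonZeroP-subst τ (surjective-gArgA n r s i (suc i + r) (NP.<⇒≤ i<s) hn (sym (NP.+-suc i r))) (den G) nG)
    where
    σ : Fin r → Poly n
    σ j = X n (suc i + pos j)
    τ : Fin s → Poly n
    τ j = ariGArg n r i (suc i + r) (pos j)

NonZeroP-den-⊙ari : ∀ (f g : Seq) → WF f → WF g → ∀ n → NonZeroP (den ((f ⊙ari g) n))
NonZeroP-den-⊙ari f g wf wg n = NonZeroP-den-≡ (sym (cong sumR (LP.map-upTo (λ r → ariTerm n r (n ∸ r) (f r) (g (n ∸ r))) (suc n))))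
  (NonZeroP-den-sum (λ r → ariTerm n r (n ∸ r) (f r) (g (n ∸ r))) (suc n) λ r r< →
    NonZeroP-den-ariTerm n r (n ∸ r) (f r) (g (n ∸ r)) (wf r) (wg (n ∸ r)) (NP.≤-reflexive (NP.m+[n∸m]≡n (NP.≤-pred r<))))

WF-ari : ∀ (f g : Seq) → WF f → WF g → WF (ari f g)
WF-ari f g wf wg n = NonZeroP-⊗ (den ((f ⊙ari g) n)) (den ((g ⊙ari f) n)) (NonZeroP-den-⊙ari f g wf wg n) (NonZeroP-den-⊙ari g f wg wf n)

-- ari respects the grading of 𝒬

ariTermV-+ : ∀ n r s (F1 F2 F3 : Point r → ℚ) (G1 G2 G3 : Point s → ℚ) x →
  (∀ u w → F1 u *q G1 w ≡ F2 u *q G2 w +q F3 u *q G3 w) →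
  ariTermV n r s F1 G1 x ≡ ariTermV n r s F2 G2 x +q ariTermV n r s F3 G3 x
ariTermV-+ n r s F1 F2 F3 G1 G2 G3 x H =
  trans (cong₂ _-q_ (∑<-+ (suc s) (a F1 G1) (a F2 G2) (a F3 G3) (λ i _ → H (fArg n r i x) (gArgA n r s i x)))
                    (∑<-+ s (b F1 G1) (b F2 G2) (b F3 G3) (λ i _ → H (fArg n r (suc i) x) (gArgB n r s (suc i) x))))
        (l (∑< (suc s) (a F2 G2)) (∑< (suc s) (a F3 G3)) (∑< s (b F2 G2)) (∑< s (b F3 G3)))
  where
  a : (Point r → ℚ) → (Point s → ℚ) → ℕ → ℚ
  a F G i = F (fArg n r i x) *q G (gArgA n r s i x)
  b : (Point r → ℚ) → (Point s → ℚ) → ℕ → ℚ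
  b F G i = F (fArg n r (suc i) x) *q G (gArgB n r s (suc i) x)
  l : ∀ a b c d → (a +q b) -q (c +q d) ≡ (a -q c) +q (b -q d)
  l = solve-∀ ℚ-ring

ariTermV-scale : ∀ n r s c (F1 F2 : Point r → ℚ) (G1 G2 : Point s → ℚ) x →
  (∀ u w → F1 u *q G1 w ≡ c *q (F2 u *q G2 w)) →
  ariTermV n r s F1 G1 x ≡ c *q ariTermV n r s F2 G2 x
ariTermV-scale n r s c F1 F2 G1 G2 x H =
  trans (cong₂ _-q_ (∑<-scale (suc s) c (a F1 G1) (a F2 G2) (λ i _ → H (fArg n r i x) (gArgA n r s i x)))
                    (∑<-scale s c (b F1 G1) (b F2 G2) (λ i _ → H (fArg n r (suc i) x) (gArgB n r s (suc i) x))))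
        (l c (∑< (suc s) (a F2 G2)) (∑< s (b F2 G2)))
  where
  a : (Point r → ℚ) → (Point s → ℚ) → ℕ → ℚ
  a F G i = F (fArg n r i x) *q G (gArgA n r s i x)
  b : (Point r → ℚ) → (Point s → ℚ) → ℕ → ℚ
  b F G i = F (fArg n r (suc i) x) *q G (gArgB n r s (suc i) x)
  l : ∀ c a b → c *q a -q c *q b ≡ c *q (a -q b)
  l = solve-∀ ℚ-ring

⊙ariV-+ : ∀ (f1 f2 f3 g1 g2 g3 : Values) n x →
  (∀ r → r < suc n → ∀ u w → f1 r u *q g1 (n ∸ r) w ≡ f2 r u *q g2 (n ∸ r) w +q f3 r u *q g3 (n ∸ r) w) →
  ⊙ariV f1 g1 n x ≡ ⊙ariV f2 g2 n x +q ⊙ariV f3 g3 n x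
⊙ariV-+ f1 f2 f3 g1 g2 g3 n x H = ∑<-+ (suc n) (t f1 g1) (t f2 g2) (t f3 g3) λ r r< →
  ariTermV-+ n r (n ∸ r) (f1 r) (f2 r) (f3 r) (g1 (n ∸ r)) (g2 (n ∸ r)) (g3 (n ∸ r)) x (H r r<)
  where
  t : Values → Values → ℕ → ℚ
  t f g r = ariTermV n r (n ∸ r) (f r) (g (n ∸ r)) x

⊙ariV-scale : ∀ (f1 f2 g1 g2 : Values) c n x →
  (∀ r → r < suc n → ∀ u w → f1 r u *q g1 (n ∸ r) w ≡ c *q (f2 r u *q g2 (n ∸ r) w)) →
  ⊙ariV f1 g1 n x ≡ c *q ⊙ariV f2 g2 n x
⊙ariV-scale f1 f2 g1 g2 c n x H = ∑<-scale (suc n) c (t f1 g1) (t f2 g2) λ r r< →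
  ariTermV-scale n r (n ∸ r) c (f1 r) (f2 r) (g1 (n ∸ r)) (g2 (n ∸ r)) x (H r r<)
  where
  t : Values → Values → ℕ → ℚ
  t f g r = ariTermV n r (n ∸ r) (f r) (g (n ∸ r)) x

valueSum : List (ℤ × Seq) → Values
valueSum l r u = ∑L l (λ kp → value (proj₂ kp r) u)

Defined-sumS : ∀ (l : List (ℤ × Seq)) n x → Defined (sumS l n) x → All (λ kp → Defined (proj₂ kp n) x) l
Defined-sumS [] n x g = []
Defined-sumS ((k , p) ∷ l) n x g = proj₁ (Defined-+ (p n) (sumS l n) x g) ∷ Defined-sumS l n x (proj₂ (Defined-+ (p n) (sumS l n) x g))

value-sumS : ∀ (l : List (ℤ × Seq)) n x → Defined (sumS l n) x → value (sumS l n) x ≡ valueSum l n x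
value-sumS [] n x g = value-zero x
value-sumS ((k , p) ∷ l) n x g = trans (value-+ (p n) (sumS l n) x g) (cong (value (p n) x +q_) (value-sumS l n x (proj₂ (Defined-+ (p n) (sumS l n) x g))))

⊙ariV-sumˡ : ∀ (l : List (ℤ × Seq)) (vg : Values) n x → ⊙ariV (valueSum l) vg n x ≡ ∑L l (λ kp → ⊙ariV (values (proj₂ kp)) vg n x)
⊙ariV-sumˡ [] vg n x = trans (⊙ariV-scale (valueSum []) (λ _ _ → 0ℚ) vg vg 0ℚ n x (λ r _ u w → l0 (vg (n ∸ r) w))) (QP.*-zeroˡ (⊙ariV (λ _ _ → 0ℚ) vg n x))
  where
  l0 : ∀ a → 0ℚ *q a ≡ 0ℚ *q (0ℚ *q a)
  l0 = solve-∀ ℚ-ring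
⊙ariV-sumˡ ((k , p) ∷ l) vg n x =
  trans (⊙ariV-+ (valueSum ((k , p) ∷ l)) (values p) (valueSum l) vg vg vg n x (λ r _ u w → QP.*-distribʳ-+ (vg (n ∸ r) w) (value (p r) u) (valueSum l r u)))
        (cong (⊙ariV (values p) vg n x +q_) (⊙ariV-sumˡ l vg n x))

⊙ariV-sumʳ : ∀ (vf : Values) (l : List (ℤ × Seq)) n x → ⊙ariV vf (valueSum l) n x ≡ ∑L l (λ kp → ⊙ariV vf (values (proj₂ kp)) n x)
⊙ariV-sumʳ vf [] n x = trans (⊙ariV-scale vf (λ _ _ → 0ℚ) (valueSum []) vf 0ℚ n x (λ r _ u w → l0 (vf r u) (vf (n ∸ r) w))) (QP.*-zeroˡ (⊙ariV (λ _ _ → 0ℚ) vf n x))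
  where
  l0 : ∀ a b → a *q 0ℚ ≡ 0ℚ *q (0ℚ *q b)
  l0 = solve-∀ ℚ-ring
⊙ariV-sumʳ vf ((k , p) ∷ l) n x =
  trans (⊙ariV-+ vf vf vf (valueSum ((k , p) ∷ l)) (values p) (valueSum l) n x (λ r _ u w → QP.*-distribˡ-+ (vf r u) (value (p (n ∸ r)) w) (valueSum l (n ∸ r) w)))
        (cong (⊙ariV vf (values p) n x +q_) (⊙ariV-sumʳ vf l n x))

⊙ariV-bilinear : ∀ (lf lg : List (ℤ × Seq)) n x →
  ⊙ariV (valueSum lf) (valueSum lg) n x ≡ ∑L lf (λ kf → ∑L lg (λ kg → ⊙ariV (values (proj₂ kf)) (values (proj₂ kg)) n x))
⊙ariV-bilinear lf lg n x =
  trans (⊙ariV-sumˡ lf (valueSum lg) n x) (∑L-cong lf _ _ λ kf → ⊙ariV-sumʳ (values (proj₂ kf)) lg n x)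

ariV-bilinear : ∀ (lf lg : List (ℤ × Seq)) n x →
  ariV (valueSum lf) (valueSum lg) n x ≡ ∑L lf (λ kf → ∑L lg (λ kg → ariV (values (proj₂ kf)) (values (proj₂ kg)) n x))
ariV-bilinear lf lg n x =
  begin
    ⊙ariV (valueSum lf) (valueSum lg) n x -q ⊙ariV (valueSum lg) (valueSum lf) n x
  ≡⟨ cong₂ _-q_ (⊙ariV-bilinear lf lg n x) (⊙ariV-bilinear lg lf n x) ⟩
    ∑L lf (λ kf → ∑L lg (λ kg → fg kf kg)) -q ∑L lg (λ kg → ∑L lf (λ kf → fg kg kf))
  ≡⟨ cong (λ z → ∑L lf (λ kf → ∑L lg (λ kg → fg kf kg)) -q z) (∑L-swap lg lf (λ kg kf → fg kg kf)) ⟩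
    ∑L lf (λ kf → ∑L lg (λ kg → fg kf kg)) -q ∑L lf (λ kf → ∑L lg (λ kg → fg kg kf))
  ≡⟨ sym (∑L-- lf (λ kf → ∑L lg (λ kg → fg kf kg)) (λ kf → ∑L lg (λ kg → fg kg kf))) ⟩
    ∑L lf (λ kf → ∑L lg (λ kg → fg kf kg) -q ∑L lg (λ kg → fg kg kf))
  ≡⟨ ∑L-cong lf _ _ (λ kf → sym (∑L-- lg (fg kf) (λ kg → fg kg kf))) ⟩
    ∑L lf (λ kf → ∑L lg (λ kg → fg kf kg -q fg kg kf))
  ∎
  where
  open ≡-Reasoning
  fg : ℤ × Seq → ℤ × Seq → ℚ
  fg ka kb = ⊙ariV (values (proj₂ ka)) (values (proj₂ kb)) n x

WF-sumS : ∀ (l : List (ℤ × Seq)) → All (λ kp → WF (proj₂ kp)) l → WF (sumS l)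
WF-sumS [] [] r = NonZeroP-1
WF-sumS ((k , p) ∷ l) (w ∷ ws) r = NonZeroP-⊗ (den (p r)) (den (sumS l r)) (w r) (WF-sumS l ws r)

ariPair : ℤ × Seq → ℤ × Seq → ℤ × Seq
ariPair kf kg = (proj₁ kf ℤ.+ proj₁ kg , ari (proj₂ kf) (proj₂ kg))

ariPairs : List (ℤ × Seq) → List (ℤ × Seq) → List (ℤ × Seq)
ariPairs [] lg = []
ariPairs (kf ∷ lf) lg = map (ariPair kf) lg ++ ariPairs lf lg

All-ariPairs⁺ : ∀ {P : ℤ × Seq → Set} lf lg → All (λ kf → All (λ kg → P (ariPair kf kg)) lg) lf → All P (ariPairs lf lg)
All-ariPairs⁺ [] lg [] = []
All-ariPairs⁺ (kf ∷ lf) lg (h ∷ hs) = AllP.++⁺ (AllP.map⁺ h) (All-ariPairs⁺ lf lg hs)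

All-ariPairs⁻ : ∀ {P : ℤ × Seq → Set} lf lg → All P (ariPairs lf lg) → All (λ kf → All (λ kg → P (ariPair kf kg)) lg) lf
All-ariPairs⁻ [] lg _ = []
All-ariPairs⁻ (kf ∷ lf) lg h = AllP.map⁻ (AllP.++⁻ˡ (map (ariPair kf) lg) h) ∷ All-ariPairs⁻ lf lg (AllP.++⁻ʳ (map (ariPair kf) lg) h)

∑L-ariPairs : ∀ lf lg (h : ℤ × Seq → ℚ) → ∑L (ariPairs lf lg) h ≡ ∑L lf (λ kf → ∑L lg (λ kg → h (ariPair kf kg)))
∑L-ariPairs [] lg h = refl
∑L-ariPairs (kf ∷ lf) lg h = trans (∑L-++ (map (ariPair kf) lg) (ariPairs lf lg) h)
  (cong₂ _+q_ (∑L-map (ariPair kf) lg h) (∑L-ariPairs lf lg h))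

ari-sumS : ∀ (f g : Seq) (lf lg : List (ℤ × Seq)) → WF f → WF g →
  All (λ kp → WF (proj₂ kp)) lf → All (λ kp → WF (proj₂ kp)) lg →
  f ≈S sumS lf → g ≈S sumS lg → ari f g ≈S sumS (ariPairs lf lg)
ari-sumS f g lf lg wf wg wlf wlg ef eg n = ≈R-from-value≡ {p = ari f g n} {q = sumS lh n} (den (ari F G n)) nzD main
  where
  F G : Seq
  F = sumS lf
  G = sumS lg
  lh : List (ℤ × Seq)
  lh = ariPairs lf lg
  wlh : All (λ kp → WF (proj₂ kp)) lh
  wlh = All-ariPairs⁺ lf lg (All.map (λ {kf} wa → All.map (λ {kg} wb → WF-ari (proj₂ kf) (proj₂ kg) wa wb) wlg) wlf)
  nzD : NonZeroP ((den (ari f g n) ⊗ den (sumS lh n)) ⊗ den (ari F G n))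
  nzD = NonZeroP-⊗ (den (ari f g n) ⊗ den (sumS lh n)) (den (ari F G n))
          (NonZeroP-⊗ (den (ari f g n)) (den (sumS lh n)) (WF-ari f g wf wg n) (WF-sumS lh wlh n))
          (WF-ari F G (WF-sumS lf wlf) (WF-sumS lg wlg) n)
  main : ∀ x → Defined (ari f g n) x → Defined (sumS lh n) x → Defined (ari F G n) x →
    value (ari f g n) x ≡ value (sumS lh n) x
  main x dA dH dP =
    begin
      value (ari f g n) x
    ≡⟨ value-ari f g n x dA ⟩
      ariV (values f) (values g) n x
    ≡⟨ ariV-cong (values f) (values g) (values F) (values G) n x
         (AtArgs-map (value-≈S f F ef) (value-≈S g G eg) (AtArgs-zip {P = DefinedP f} {DefinedP g} {DefinedP F} {DefinedP G} (proj₁ argsA) (proj₁ argsP)))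
         (AtArgs-map (value-≈S g G eg) (value-≈S f F ef) (AtArgs-zip {P = DefinedP g} {DefinedP f} {DefinedP G} {DefinedP F} (proj₂ argsA) (proj₂ argsP))) ⟩
      ariV (values F) (values G) n x
    ≡⟨ ariV-cong (values F) (values G) (valueSum lf) (valueSum lg) n x
         (AtArgs-map (value-sumS lf) (value-sumS lg) (proj₁ argsP))
         (AtArgs-map (value-sumS lg) (value-sumS lf) (proj₂ argsP)) ⟩
      ariV (valueSum lf) (valueSum lg) n x
    ≡⟨ ariV-bilinear lf lg n x ⟩
      ∑L lf (λ kf → ∑L lg (λ kg → ariV (values (proj₂ kf)) (values (proj₂ kg)) n x))
    ≡⟨ ∑L-congAll lf _ _ (All.map (λ {kf} ds → ∑L-congAll lg _ _ (All.map (λ {kg} d → sym (value-ari (proj₂ kf) (proj₂ kg) n x d)) ds))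
                                  (All-ariPairs⁻ lf lg (Defined-sumS lh n x dH))) ⟩
      ∑L lf (λ kf → ∑L lg (λ kg → value (proj₂ (ariPair kf kg) n) x))
    ≡⟨ sym (∑L-ariPairs lf lg (λ kp → value (proj₂ kp n) x)) ⟩
      valueSum lh n x
    ≡⟨ sym (value-sumS lh n x dH) ⟩
      value (sumS lh n) x
    ∎
    where
    open ≡-Reasoning
    argsA : AtArgs (DefinedP f) (DefinedP g) n x × AtArgs (DefinedP g) (DefinedP f) n x
    argsA = Defined⇒AtArgs-ari f g n x dA
    argsP : AtArgs (DefinedP F) (DefinedP G) n x × AtArgs (DefinedP G) (DefinedP F) n x
    argsP = Defined⇒AtArgs-ari F G n x dP

pow : ℚ → ℕ → ℚ
pow t zero = 1ℚ
pow t (suc m) = t *q pow t m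

pow-≢0 : ∀ t m → t ≢ 0ℚ → pow t m ≢ 0ℚ
pow-≢0 t zero h ()
pow-≢0 t (suc m) h = *-≢0 t (pow t m) h (pow-≢0 t m h)

pow-suc : ∀ t m → pow t (m ℕ.+ 1) ≡ pow t m *q t
pow-suc t zero = trans (QP.*-identityʳ t) (sym (QP.*-identityˡ t))
pow-suc t (suc m) = trans (cong (t *q_) (pow-suc t m)) (sym (QP.*-assoc t (pow t m) t))

zpow : ℚ → ℤ → ℚ
zpow t (ℤ.+ m) = pow t m
zpow t ℤ.-[1+ m ] = inv0 (pow t (suc m))

zpow-suc : ∀ t → t ≢ 0ℚ → ∀ a → zpow t (a ℤ.+ ℤ.+ 1) ≡ zpow t a *q t
zpow-suc t h (ℤ.+ m) = pow-suc t m
zpow-suc t h ℤ.-[1+ zero ] = sym (trans (cong (_*q t) (cong inv0 (QP.*-identityʳ t))) (trans (QP.*-comm (inv0 t) t) (*-inv0 t h)))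
zpow-suc t h ℤ.-[1+ suc m ] = inv0-unique (t *q pow t m) (inv0 C *q t) (pow-≢0 t (suc m) h)
  (trans (l (inv0 C) t (pow t m)) (trans (QP.*-comm (inv0 C) C) (*-inv0 C (pow-≢0 t (suc (suc m)) h))))
  where
  C = t *q (t *q pow t m)
  l : ∀ i t p → (i *q t) *q (t *q p) ≡ i *q (t *q (t *q p))
  l = solve-∀ ℚ-ring

zpow-+pow : ∀ t → t ≢ 0ℚ → ∀ a m → zpow t (a ℤ.+ ℤ.+ m) ≡ zpow t a *q pow t m
zpow-+pow t h a zero = trans (cong (zpow t) (ℤP.+-identityʳ a)) (sym (QP.*-identityʳ _))
zpow-+pow t h a (suc m) =
  trans (cong (zpow t) (trans (cong (λ z → a ℤ.+ z) (cong ℤ.+_ (NP.+-comm 1 m))) (sym (ℤP.+-assoc a (ℤ.+ m) (ℤ.+ 1)))))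
    (trans (zpow-suc t h (a ℤ.+ ℤ.+ m)) (trans (cong (_*q t) (zpow-+pow t h a m)) (l (zpow t a) (pow t m) t)))
  where
  l : ∀ a p t → (a *q p) *q t ≡ a *q (t *q p)
  l = solve-∀ ℚ-ring

zpow-+ : ∀ t → t ≢ 0ℚ → ∀ a b → zpow t a *q zpow t b ≡ zpow t (a ℤ.+ b)
zpow-+ t h a (ℤ.+ m) = sym (zpow-+pow t h a m)
zpow-+ t h a ℤ.-[1+ m ] = sym (trans (sym (QP.*-identityʳ (zpow t c)))
   (trans (cong (zpow t c *q_) (sym (*-inv0 P hP)))
     (trans (sym (QP.*-assoc (zpow t c) P (inv0 P)))
       (cong (_*q inv0 P) (trans (sym (zpow-+pow t h c (suc m))) (cong (zpow t) e))))))
  where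
  c = a ℤ.+ ℤ.-[1+ m ]
  P = pow t (suc m)
  hP = pow-≢0 t (suc m) h
  e : c ℤ.+ ℤ.+ suc m ≡ a
  e = trans (ℤP.+-assoc a ℤ.-[1+ m ] (ℤ.+ suc m)) (trans (cong (λ z → a ℤ.+ z) (ℤP.+-inverseˡ (ℤ.+ suc m))) (ℤP.+-identityʳ a))

-+-distrib : ∀ k k' a b → (k ℤ.- a) ℤ.+ (k' ℤ.- b) ≡ (k ℤ.+ k') ℤ.- (a ℤ.+ b)
-+-distrib = solve-∀ ℤ-ring

zpow-degree : ∀ t → t ≢ 0ℚ → ∀ k k' n r → r ≤ n → zpow t (k ℤ.- ℤ.+ r) *q zpow t (k' ℤ.- ℤ.+ (n ∸ r)) ≡ zpow t ((k ℤ.+ k') ℤ.- ℤ.+ n)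
zpow-degree t ht k k' n r h =
  trans (zpow-+ t ht (k ℤ.- ℤ.+ r) (k' ℤ.- ℤ.+ (n ∸ r)))
        (cong (zpow t) (trans (-+-distrib k k' (ℤ.+ r) (ℤ.+ (n ∸ r)))
                              (cong (λ z → (k ℤ.+ k') ℤ.- z) (cong ℤ.+_ (NP.m+[n∸m]≡n h)))))

eval-tpowP : ∀ {r} m (z : Point (suc r)) → eval (tpowP {r} m) z ≡ pow (z zero) m
eval-tpowP zero z = refl
eval-tpowP (suc m) z = cong (z zero *q_) (eval-tpowP m z)

value-tpow : ∀ {r} d (z : Point (suc r)) → value (tpow {r} d) z ≡ zpow (z zero) d
value-tpow (ℤ.+ m) z = trans (cong₂ _*q_ (eval-tpowP m z) inv0-1) (QP.*-identityʳ _)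
value-tpow ℤ.-[1+ m ] z = trans (QP.*-identityˡ _) (cong inv0 (eval-tpowP (suc m) z))

Defined-tpow : ∀ {r} d (z : Point (suc r)) → z zero ≢ 0ℚ → Defined (tpow {r} d) z
Defined-tpow (ℤ.+ m) z h ()
Defined-tpow ℤ.-[1+ m ] z h e = pow-≢0 (z zero) (suc m) h (trans (sym (eval-tpowP (suc m) z)) e)

NonZeroP-tpowP : ∀ {r} m → NonZeroP (tpowP {r} m)
NonZeroP-tpowP zero = NonZeroP-1
NonZeroP-tpowP (suc m) = NonZeroP-⊗ (var zero) (tpowP m) (λ h → QP.1≢0 (h (λ _ → 1ℚ))) (NonZeroP-tpowP m)

NonZeroP-den-tpow : ∀ {r} d → NonZeroP (den (tpow {r} d))
NonZeroP-den-tpow (ℤ.+ m) = NonZeroP-1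
NonZeroP-den-tpow ℤ.-[1+ m ] = NonZeroP-tpowP (suc m)

scale : ∀ {n} → ℚ → Point n → Point n
scale t x i = t *q x i

cons : ∀ {r} → ℚ → Point r → Point (suc r)
cons t u zero = t
cons t u (suc i) = u i

Linear : ∀ {n} → Poly n → Set
Linear {n} p = ∀ t (x : Point n) → eval p (scale t x) ≡ t *q eval p x

Linear-X : ∀ n k → Linear (X n k)
Linear-X n zero t x = sym (QP.*-zeroʳ t)
Linear-X n (suc k) t x with k NP.<? n
... | yes _ = refl
... | no _ = sym (QP.*-zeroʳ t)

Linear-sumX : ∀ n a b → Linear (sumX n a b)
Linear-sumX n a b t x = trans (eval-sumX n a b (scale t x))
  (trans (∑<-scale (suc b ∸ a) t _ (λ j → eval (X n (a ℕ.+ j)) x) (λ j _ → Linear-X n (a ℕ.+ j) t x)) (cong (t *q_) (sym (eval-sumX n a b x))))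

Linear-if : ∀ {n} (b : Bool) (p q : Poly n) → Linear p → Linear q → Linear (if b then p else q)
Linear-if true p q lp lq = lp
Linear-if false p q lp lq = lq

fArg-scale : ∀ n r i t x j → fArg n r i (scale t x) j ≡ t *q fArg n r i x j
fArg-scale n r i t x j = Linear-X n (i ℕ.+ pos j) t x

gArgA-scale : ∀ n r s i t x j → gArgA n r s i (scale t x) j ≡ t *q gArgA n r s i x j
gArgA-scale n r s i t x j = Linear-if (pos j ≤ᵇ i) _ _ (Linear-X n (pos j)) (Linear-if (pos j ≤ᵇ suc i) _ _ (Linear-sumX n (suc i) (i ℕ.+ r ℕ.+ 1)) (Linear-X n (pos j ℕ.+ r))) t x

gArgB-scale : ∀ n r s i t x j → gArgB n r s i (scale t x) j ≡ t *q gArgB n r s i x j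
gArgB-scale n r s i t x j = Linear-if (pos j ≤ᵇ (i ∸ 1)) _ _ (Linear-X n (pos j)) (Linear-if (pos j ≤ᵇ i) _ _ (Linear-sumX n i (i ℕ.+ r)) (Linear-X n (pos j ℕ.+ r))) t x

⊙ariV-scale-point : ∀ (vf vg : Values) → PointCong vf → PointCong vg → ∀ n t x →
  ⊙ariV vf vg n (scale t x) ≡ ⊙ariV (λ r w → vf r (scale t w)) (λ s w → vg s (scale t w)) n x
⊙ariV-scale-point vf vg cf cg n t x = ∑<-cong (suc n) _ _ λ r _ →
  cong₂ _-q_ (∑<-cong (suc (n ∸ r)) _ _ (λ i _ → cong₂ _*q_ (cf r (fArg-scale n r i t x)) (cg (n ∸ r) (gArgA-scale n r (n ∸ r) i t x))))
             (∑<-cong (n ∸ r) _ _ (λ i _ → cong₂ _*q_ (cf r (fArg-scale n r (suc i) t x)) (cg (n ∸ r) (gArgB-scale n r (n ∸ r) (suc i) t x))))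

AtArgs-scale : ∀ (P Q : PointPred) → (∀ r {u u' : Point r} → (∀ j → u j ≡ u' j) → P r u → P r u') → (∀ r {u u' : Point r} → (∀ j → u j ≡ u' j) → Q r u → Q r u') →
  ∀ n t x → AtArgs P Q n (scale t x) → AtArgs (λ r w → P r (scale t w)) (λ s w → Q s (scale t w)) n x
AtArgs-scale P Q cp cq n t x U r r< =
    (λ i i< → cp r (fArg-scale n r i t x) (proj₁ (proj₁ (U r r<) i i<)) , cq (n ∸ r) (gArgA-scale n r (n ∸ r) i t x) (proj₂ (proj₁ (U r r<) i i<)))
  , (λ i i< → cp r (fArg-scale n r (suc i) t x) (proj₁ (proj₂ (U r r<) i i<)) , cq (n ∸ r) (gArgB-scale n r (n ∸ r) (suc i) t x) (proj₂ (proj₂ (U r r<) i i<)))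

homogeneous-value : ∀ {r} d (F : RatFun r) → Homogeneous d F → ∀ t (u : Point r) → t ≢ 0ℚ → Defined F (scale t u) → Defined F u →
  value F (scale t u) ≡ zpow t d *q value F u
homogeneous-value d F H t u ht g1 g2 =
  trans (sym (value-subst scaleσ F z))
    (trans (≈R⇒value≡ {p = substR scaleσ F} {q = tpow d *R substR weakσ F} H z gL gR)
      (trans (value-* (tpow d) (substR weakσ F) z gR) (cong₂ _*q_ (value-tpow d z) (value-subst weakσ F z))))
  where
  z = cons t u
  gL : Defined (substR scaleσ F) z
  gL = Defined-subst⁻ scaleσ F z g1
  gR : Defined (tpow d *R substR weakσ F) z
  gR = *-≢0 (eval (den (tpow d)) z) (eval (den (substR weakσ F)) z) (Defined-tpow d z ht) (Defined-subst⁻ weakσ F z g2)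

⊙ariV-homogeneous : ∀ k k' (fa gb : Seq) n t (u : Point n) → t ≢ 0ℚ → InQk k fa → InQk k' gb →
  AtArgs (DefinedP fa) (DefinedP gb) n (scale t u) → AtArgs (DefinedP fa) (DefinedP gb) n u →
  ⊙ariV (values fa) (values gb) n (scale t u) ≡ zpow t ((k ℤ.+ k') ℤ.- ℤ.+ n) *q ⊙ariV (values fa) (values gb) n u
⊙ariV-homogeneous k k' fa gb n t u ht hf hg Us Uu =
  trans (⊙ariV-scale-point (values fa) (values gb) (values-cong fa) (values-cong gb) n t u)
    (trans (⊙ariV-cong (λ r w → value (fa r) (scale t w)) (λ s w → value (gb s) (scale t w)) f1 g1 n u Ueq)
           (⊙ariV-scale f1 (values fa) g1 (values gb) c n u H))
  where
  c = zpow t ((k ℤ.+ k') ℤ.- ℤ.+ n)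
  f1 : Values
  f1 r w = zpow t (k ℤ.- ℤ.+ r) *q value (fa r) w
  g1 : Values
  g1 s w = zpow t (k' ℤ.- ℤ.+ s) *q value (gb s) w
  Usc = AtArgs-scale (DefinedP fa) (DefinedP gb) (DefinedP-cong fa) (DefinedP-cong gb) n t u Us
  Ueq : AtArgs (λ r w → value (fa r) (scale t w) ≡ f1 r w) (λ s w → value (gb s) (scale t w) ≡ g1 s w) n u
  Ueq = AtArgs-map (λ r w gg → homogeneous-value (k ℤ.- ℤ.+ r) (fa r) (hf r) t w ht (proj₁ gg) (proj₂ gg))
                  (λ s w gg → homogeneous-value (k' ℤ.- ℤ.+ s) (gb s) (hg s) t w ht (proj₁ gg) (proj₂ gg))
                  (AtArgs-zip {P = λ r w → DefinedP fa r (scale t w)} {Q = λ s w → DefinedP gb s (scale t w)} {P' = DefinedP fa} {Q' = DefinedP gb} Usc Uu)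
  l : ∀ a b x y → (a *q x) *q (b *q y) ≡ (a *q b) *q (x *q y)
  l = solve-∀ ℚ-ring
  H : ∀ r → r < suc n → ∀ w w' → f1 r w *q g1 (n ∸ r) w' ≡ c *q (value (fa r) w *q value (gb (n ∸ r)) w')
  H r r< w w' =
    trans (l (zpow t (k ℤ.- ℤ.+ r)) (zpow t (k' ℤ.- ℤ.+ (n ∸ r))) (value (fa r) w) (value (gb (n ∸ r)) w'))
          (cong (_*q (value (fa r) w *q value (gb (n ∸ r)) w')) (zpow-degree t ht k k' n r (NP.≤-pred r<)))

InQk-ari : ∀ k k' (fa gb : Seq) → WF fa → WF gb → InQk k fa → InQk k' gb → InQk (k ℤ.+ k') (ari fa gb)
InQk-ari k k' fa gb wf wg hf hg n = ≈R-from-value≡ {p = substR scaleσ A} {q = tpow d *R substR weakσ A} (var zero) nzD main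
  where
  A : RatFun n
  A = ari fa gb n
  d : ℤ
  d = (k ℤ.+ k') ℤ.- ℤ.+ n
  surjective-scaleσ : Surjective {n} {suc n} scaleσ
  surjective-scaleσ y = cons 1ℚ y , λ j → QP.*-identityˡ (y j)
  surjective-weakσ : Surjective {n} {suc n} weakσ
  surjective-weakσ y = cons 0ℚ y , λ j → refl
  nzA : NonZeroP (den A)
  nzA = WF-ari fa gb wf wg n
  nzD : NonZeroP ((den (substR scaleσ A) ⊗ den (tpow d *R substR weakσ A)) ⊗ var zero)
  nzD = NonZeroP-⊗ (den (substR scaleσ A) ⊗ den (tpow d *R substR weakσ A)) (var zero)
          (NonZeroP-⊗ (den (substR scaleσ A)) (den (tpow d *R substR weakσ A)) (NonZeroP-subst scaleσ surjective-scaleσ (den A) nzA)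
                (NonZeroP-⊗ (den (tpow d)) (substP weakσ (den A)) (NonZeroP-den-tpow d) (NonZeroP-subst weakσ surjective-weakσ (den A) nzA)))
          (λ h → QP.1≢0 (h (λ _ → 1ℚ)))
  main : ∀ z → Defined (substR scaleσ A) z → Defined (tpow d *R substR weakσ A) z → z zero ≢ 0ℚ →
    value (substR scaleσ A) z ≡ value (tpow d *R substR weakσ A) z
  main z dL dR ht =
    begin
      value (substR scaleσ A) z
    ≡⟨ value-subst scaleσ A z ⟩
      value A (scale t u)
    ≡⟨ value-ari fa gb n (scale t u) dtu ⟩
      ⊙ariV (values fa) (values gb) n (scale t u) -q ⊙ariV (values gb) (values fa) n (scale t u)
    ≡⟨ cong₂ _-q_ eFG eGF ⟩
      zpow t d *q ⊙ariV (values fa) (values gb) n u -q zpow t d *q ⊙ariV (values gb) (values fa) n u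
    ≡⟨ lsub (zpow t d) (⊙ariV (values fa) (values gb) n u) (⊙ariV (values gb) (values fa) n u) ⟩
      zpow t d *q ariV (values fa) (values gb) n u
    ≡⟨ cong₂ _*q_ (sym (value-tpow d z)) (sym (value-ari fa gb n u du)) ⟩
      value (tpow d) z *q value A u
    ≡⟨ cong (value (tpow d) z *q_) (sym (value-subst weakσ A z)) ⟩
      value (tpow d) z *q value (substR weakσ A) z
    ≡⟨ sym (value-* (tpow d) (substR weakσ A) z dR) ⟩
      value (tpow d *R substR weakσ A) z
    ∎
    where
    open ≡-Reasoning
    t : ℚ
    t = z zero
    u : Point n
    u i = z (suc i)
    dtu : Defined A (scale t u)
    dtu = Defined-subst scaleσ A z dL
    du : Defined A u
    du = Defined-subst weakσ A z (proj₂ (Defined-* (tpow d) (substR weakσ A) z dR))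
    args-tu : AtArgs (DefinedP fa) (DefinedP gb) n (scale t u) × AtArgs (DefinedP gb) (DefinedP fa) n (scale t u)
    args-tu = Defined⇒AtArgs-ari fa gb n (scale t u) dtu
    args-u : AtArgs (DefinedP fa) (DefinedP gb) n u × AtArgs (DefinedP gb) (DefinedP fa) n u
    args-u = Defined⇒AtArgs-ari fa gb n u du
    eFG : ⊙ariV (values fa) (values gb) n (scale t u) ≡ zpow t d *q ⊙ariV (values fa) (values gb) n u
    eFG = ⊙ariV-homogeneous k k' fa gb n t u ht hf hg (proj₁ args-tu) (proj₁ args-u)
    eGF : ⊙ariV (values gb) (values fa) n (scale t u) ≡ zpow t d *q ⊙ariV (values gb) (values fa) n u
    eGF = trans (⊙ariV-homogeneous k' k gb fa n t u ht hg hf (proj₂ args-tu) (proj₂ args-u))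
                (cong (λ e → zpow t (e ℤ.- ℤ.+ n) *q ⊙ariV (values gb) (values fa) n u) (ℤP.+-comm k' k))
    lsub : ∀ c a b → c *q a -q c *q b ≡ c *q (a -q b)
    lsub = solve-∀ ℚ-ring

ariPairs-homogeneous : ∀ (lf lg : List (ℤ × Seq)) →
  All (λ kp → WF (proj₂ kp) × InQk (proj₁ kp) (proj₂ kp)) lf → All (λ kp → WF (proj₂ kp) × InQk (proj₁ kp) (proj₂ kp)) lg →
  All (λ kp → WF (proj₂ kp) × InQk (proj₁ kp) (proj₂ kp)) (ariPairs lf lg)
ariPairs-homogeneous lf lg hf hg = All-ariPairs⁺ lf lg (All.map (λ {kf} ha → All.map (λ {kg} hb →
  WF-ari (proj₂ kf) (proj₂ kg) (proj₁ ha) (proj₁ hb) , InQk-ari (proj₁ kf) (proj₁ kg) (proj₂ kf) (proj₂ kg) (proj₁ ha) (proj₁ hb) (proj₂ ha) (proj₂ hb)) hg) hf)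

-- ari preserves φ-skewness

rev-index-fArg : ∀ n r s i t → r + s ≡ n → i ≤ s → t < r → suc n ∸ (i + suc t) ≡ (s ∸ i) + suc (r ∸ suc t)
rev-index-fArg n r s i t e h1 h2 with NP.m≤n⇒∃[o]m+o≡n h1 | NP.m≤n⇒∃[o]m+o≡n h2
... | a , refl | b , refl with e
... | refl rewrite NP.m+n∸m≡n i a | NP.m+n∸m≡n (suc t) b =
  ≡+⇒∸≡ _ _ _ (l a b i t)
  where
  l : ∀ a b i t → suc ((suc t + b) + (i + a)) ≡ (a + suc b) + (i + suc t)
  l = NS.solve-∀

rev-index-last : ∀ n r t → r ≤ n → t < r → suc n ∸ ((n ∸ r) + suc t) ≡ suc (r ∸ suc t)
rev-index-last n r t h1 h2 with NP.m≤n⇒∃[o]m+o≡n h1 | NP.m≤n⇒∃[o]m+o≡n h2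
... | a , refl | b , refl rewrite NP.m+n∸m≡n r a | NP.m+n∸m≡n (suc t) b =
  ≡+⇒∸≡ _ _ _ (l a b t)
  where
  l : ∀ a b t → suc ((suc t + b) + a) ≡ suc b + (a + suc t)
  l = NS.solve-∀

rev-index-first : ∀ n s t → s ≤ n → t < s → suc n ∸ suc t ≡ (n ∸ s) + suc (s ∸ suc t)
rev-index-first n s t h1 h2 with NP.m≤n⇒∃[o]m+o≡n h1 | NP.m≤n⇒∃[o]m+o≡n h2
... | a , refl | b , refl rewrite NP.m+n∸m≡n s a | NP.m+n∸m≡n (suc t) b =
  ≡+⇒∸≡ _ _ _ (l a b t)
  where
  l : ∀ a b t → (suc t + b) + a ≡ (a + suc b) + t
  l = NS.solve-∀

rev-index-below : ∀ n r s i t → r + s ≡ n → i < s → t < i → suc n ∸ suc t ≡ suc (s ∸ suc t) + r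
rev-index-below n r s i t e h1 h2 with NP.m≤n⇒∃[o]m+o≡n (NP.<-trans h2 h1)
... | b , refl with e
... | refl rewrite NP.m+n∸m≡n (suc t) b = ≡+⇒∸≡ _ _ _ (l b r t)
  where
  l : ∀ b r t → r + (suc t + b) ≡ (suc b + r) + t
  l = NS.solve-∀

rev-index-above : ∀ n r s t → r + s ≡ n → t < s → suc n ∸ (suc t + r) ≡ suc (s ∸ suc t)
rev-index-above n r s t e h with NP.m≤n⇒∃[o]m+o≡n h
... | b , refl with e
... | refl rewrite NP.m+n∸m≡n (suc t) b = ≡+⇒∸≡ _ _ _ (l b r t)
  where
  l : ∀ b r t → suc (r + (suc t + b)) ≡ suc b + (suc t + r)
  l = NS.solve-∀

rev-index-merged : ∀ n r s i l → r + s ≡ n → i < s → l ≤ r → suc n ∸ (suc i + l) ≡ suc (s ∸ suc i) + (r ∸ l)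
rev-index-merged n r s i l e h1 h2 with NP.m≤n⇒∃[o]m+o≡n h1 | NP.m≤n⇒∃[o]m+o≡n h2
... | b , refl | c , refl with e
... | refl rewrite NP.m+n∸m≡n (suc i) b | NP.m+n∸m≡n l c = ≡+⇒∸≡ _ _ _ (lem b c i l)
  where
  lem : ∀ b c i l → suc ((l + c) + (suc i + b)) ≡ (suc b + c) + (suc i + l)
  lem = NS.solve-∀

firstPoint : ∀ n b → Point n → Point b
firstPoint n b x j = eval (X n (pos j)) x

lastPoint : ∀ n a → Point n → Point a
lastPoint n a x j = eval (X n ((n ∸ a) + pos j)) x

pos-opposite : ∀ {m} (j : Fin m) → pos (opposite j) ≡ suc (m ∸ suc (toℕ j))
pos-opposite j = cong suc (FP.opposite-prop j)

fArg-rev : ∀ n r s i (x : Point n) (j : Fin r) → r + s ≡ n → i ≤ s → fArg n r i (rev x) j ≡ fArg n r (s ∸ i) x (opposite j)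
fArg-rev n r s i x j e h =
  trans (eval-X-rev n x (i + pos j) (NP.≤-trans (s≤s z≤n) (NP.≤-reflexive (sym (NP.+-suc i (toℕ j))))) b)
        (eval-X-≡ n x (trans (rev-index-fArg n r s i (toℕ j) e h (FP.toℕ<n j)) (cong (λ z → (s ∸ i) + z) (sym (pos-opposite j)))))
  where
  b : i + pos j ≤ n
  b = NP.≤-trans (NP.+-mono-≤ h (FP.toℕ<n j)) (NP.≤-reflexive (trans (NP.+-comm s r) e))

lastPoint-rev : ∀ n r (x : Point n) (j : Fin r) → r ≤ n → lastPoint n r (rev x) j ≡ firstPoint n r x (opposite j)
lastPoint-rev n r x j h =
  trans (eval-X-rev n x ((n ∸ r) + pos j) (NP.≤-trans (s≤s z≤n) (NP.≤-reflexive (sym (NP.+-suc (n ∸ r) (toℕ j))))) b)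
        (eval-X-≡ n x (trans (rev-index-last n r (toℕ j) h (FP.toℕ<n j)) (sym (pos-opposite j))))
  where
  b : (n ∸ r) + pos j ≤ n
  b = NP.≤-trans (NP.+-monoʳ-≤ (n ∸ r) (FP.toℕ<n j)) (NP.≤-reflexive (NP.m∸n+n≡m h))

firstPoint-rev : ∀ n s (x : Point n) (j : Fin s) → s ≤ n → firstPoint n s (rev x) j ≡ lastPoint n s x (opposite j)
firstPoint-rev n s x j h =
  trans (eval-X-rev n x (pos j) (s≤s z≤n) (NP.≤-trans (FP.toℕ<n j) h))
        (eval-X-≡ n x (trans (rev-index-first n s (toℕ j) h (FP.toℕ<n j)) (cong (λ z → (n ∸ s) + z) (sym (pos-opposite j)))))

gArgA-last : ∀ n r s (x : Point n) (j : Fin s) → gArgA n r s s x j ≡ firstPoint n s x j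
gArgA-last n r s x j rewrite ≤⇒≤ᵇ≡true {pos j} {s} (FP.toℕ<n j) = refl

gArgA-rev : ∀ n r s i (x : Point n) (j : Fin s) → r + s ≡ n → i < s → gArgA n r s i (rev x) j ≡ gArgB n r s (s ∸ i) x (opposite j)
gArgA-rev n r s i x j e h =
  trans (cas (NP.<-cmp t i))
        (cong (λ z → gArgB n r s z x (opposite j)) (sym ek))
  where
  t = toℕ j
  o = opposite j
  k = s ∸ suc i
  ek : s ∸ i ≡ suc k
  ek = NP.+-∸-assoc 1 {s} {suc i} h
  t<s : t < s
  t<s = FP.toℕ<n j
  bnd : ∀ m → m ≤ s → m + r ≤ n
  bnd m hm = NP.≤-trans (NP.+-monoˡ-≤ r hm) (NP.≤-reflexive (trans (NP.+-comm s r) e))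
  po : pos o ≡ suc (s ∸ suc t)
  po = pos-opposite j
  cas : _ → eval (ariGArg n r i (i + r + 1) (pos j)) (rev x) ≡ eval (ariGArg n r k (suc k + r) (pos o)) x
  cas (tri< a _ _) rewrite ariGArg-below n r i (i + r + 1) (pos j) a =
    trans (eval-X-rev n x (suc t) (s≤s z≤n) (NP.≤-trans (NP.≤-trans t<s (NP.m≤n+m s r)) (NP.≤-reflexive e)))
      (trans (eval-X-≡ n x (trans (rev-index-below n r s i t e h a) (cong (_+ r) (sym po))))
        (sym (cong (λ z → eval z x) (ariGArg-above n r k (suc k + r) (pos o) hi))))
    where
    hi : suc k < pos o
    hi = NP.≤-trans (s≤s (NP.≤-reflexive (sym ek))) (NP.≤-trans (NP.∸-monoʳ-< a (NP.<⇒≤ h)) (NP.≤-reflexive (trans (NP.+-∸-assoc 1 {s} {suc t} t<s) (sym po))))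
  cas (tri≈ _ refl _) rewrite ariGArg-merged n r t (t + r + 1) =
    trans (eval-sumX n (suc t) (t + r + 1) (rev x))
      (trans (cong (λ m → ∑< m (λ l → eval (X n (suc t + l)) (rev x))) len1)
        (trans (∑<-cong (suc r) _ _ (λ l l< → trans (eval-X-rev n x (suc t + l) (s≤s z≤n) (bl l l<)) (eval-X-≡ n x (rev-index-merged n r s t l e h (NP.≤-pred l<)))))
          (trans (sym (∑<-reverse (suc r) (λ l → eval (X n (suc k + l)) x)))
            (trans (cong (λ m → ∑< m (λ l → eval (X n (suc k + l)) x)) (sym len2))
              (trans (sym (eval-sumX n (suc k) (suc k + r) x))
                (sym (trans (cong (λ z → eval (ariGArg n r k (suc k + r) z) x) po') (cong (λ z → eval z x) (ariGArg-merged n r k (suc k + r))))))))))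
    where
    po' : pos o ≡ suc k
    po' = po
    len1 : suc (t + r + 1) ∸ suc t ≡ suc r
    len1 = trans (cong (_∸ t) (NP.+-assoc t r 1)) (trans (cong (λ z → (t + z) ∸ t) (NP.+-comm r 1)) (NP.m+n∸m≡n t (suc r)))
    len2 : suc (suc k + r) ∸ suc k ≡ suc r
    len2 = trans (cong (_∸ k) (sym (NP.+-suc k r))) (NP.m+n∸m≡n k (suc r))
    bl : ∀ l → l < suc r → suc t + l ≤ n
    bl l l< = NP.≤-trans (NP.+-monoʳ-≤ (suc t) (NP.≤-pred l<)) (bnd (suc t) t<s)
  cas (tri> _ _ c) rewrite ariGArg-above n r i (i + r + 1) (pos j) (s≤s c) =
    trans (eval-X-rev n x (suc t + r) (s≤s z≤n) (bnd (suc t) t<s))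
      (trans (eval-X-≡ n x (trans (rev-index-above n r s t e t<s) (sym po)))
        (sym (cong (λ z → eval z x) (ariGArg-below n r k (suc k + r) (pos o) lo))))
    where
    lo : pos o ≤ k
    lo = NP.≤-trans (NP.≤-reflexive po) (NP.≤-trans (NP.≤-reflexive (sym (NP.+-∸-assoc 1 {s} {suc t} t<s))) (NP.∸-monoʳ-≤ s c))

gArgA-cong : ∀ n r s i {x y : Point n} → (∀ k → x k ≡ y k) → ∀ j → gArgA n r s i x j ≡ gArgA n r s i y j
gArgA-cong n r s i h j = eval-cong (if pos j ≤ᵇ i then X n (pos j)
                else if pos j ≤ᵇ suc i then sumX n (suc i) (i ℕ.+ r ℕ.+ 1)
                else X n (pos j ℕ.+ r)) h

ariTermV-rev : ∀ n r s (F : Point r → ℚ) (G : Point s → ℚ) (x : Point n) →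
  (∀ i → i < s → F (fArg n r i (rev x)) *q G (gArgA n r s i (rev x)) ≡ sign n *q (F (fArg n r (suc (s ∸ suc i)) x) *q G (gArgB n r s (suc (s ∸ suc i)) x))) →
  (∀ i → i < s → F (fArg n r (suc i) (rev x)) *q G (gArgB n r s (suc i) (rev x)) ≡ sign n *q (F (fArg n r (s ∸ suc i) x) *q G (gArgA n r s (s ∸ suc i) x))) →
  ariTermV n r s F G x +q sign n *q ariTermV n r s F G (rev x)
    ≡ F (fArg n r s x) *q G (gArgA n r s s x) +q sign n *q (F (fArg n r s (rev x)) *q G (gArgA n r s s (rev x)))
ariTermV-rev n r s F G x hA hB =
  begin
    (∑< (suc s) a -q ∑< s b) +q sign n *q (∑< (suc s) a' -q ∑< s b')
  ≡⟨ cong₂ (λ p q → (p -q ∑< s b) +q sign n *q (q -q ∑< s b')) (∑<-snoc s a) (∑<-snoc s a') ⟩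
    ((∑< s a +q a s) -q ∑< s b) +q sign n *q ((∑< s a' +q a' s) -q ∑< s b')
  ≡⟨ cong₂ (λ p q → ((∑< s a +q a s) -q ∑< s b) +q sign n *q ((p +q a' s) -q q)) e1 e2 ⟩
    ((∑< s a +q a s) -q ∑< s b) +q sign n *q ((sign n *q ∑< s b +q a' s) -q sign n *q ∑< s a)
  ≡⟨ l (sign n) (∑< s a) (a s) (∑< s b) (a' s) ⟩
    a s +q sign n *q a' s +q (sign n *q sign n -q 1ℚ) *q (∑< s b -q ∑< s a)
  ≡⟨ cong (λ z → a s +q sign n *q a' s +q (z -q 1ℚ) *q (∑< s b -q ∑< s a)) (sign-square n) ⟩
    a s +q sign n *q a' s +q (1ℚ -q 1ℚ) *q (∑< s b -q ∑< s a)
  ≡⟨ l2 (a s +q sign n *q a' s) (∑< s b -q ∑< s a) ⟩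
    a s +q sign n *q a' s
  ∎
  where
  open ≡-Reasoning
  a = λ i → F (fArg n r i x) *q G (gArgA n r s i x)
  b = λ i → F (fArg n r (suc i) x) *q G (gArgB n r s (suc i) x)
  a' = λ i → F (fArg n r i (rev x)) *q G (gArgA n r s i (rev x))
  b' = λ i → F (fArg n r (suc i) (rev x)) *q G (gArgB n r s (suc i) (rev x))
  e1 : ∑< s a' ≡ sign n *q ∑< s b
  e1 = trans (∑<-scale s (sign n) a' (λ i → b (s ∸ suc i)) hA) (cong (sign n *q_) (sym (∑<-reverse s b)))
  e2 : ∑< s b' ≡ sign n *q ∑< s a
  e2 = trans (∑<-scale s (sign n) b' (λ i → a (s ∸ suc i)) hB) (cong (sign n *q_) (sym (∑<-reverse s a)))
  l : ∀ c A as B as' → ((A +q as) -q B) +q c *q ((c *q B +q as') -q c *q A) ≡ as +q c *q as' +q (c *q c -q 1ℚ) *q (B -q A)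
  l = solve-∀ ℚ-ring
  l2 : ∀ p q → p +q (1ℚ -q 1ℚ) *q q ≡ p
  l2 = solve-∀ ℚ-ring

ariTermV-rev-boundary : ∀ n r s → r + s ≡ n → (F : RatFun r) (G : RatFun s) → φ-SkewValues F → φ-SkewValues G → ∀ x →
  AtTermArgs n r s (Defined F) (Defined G) x → AtTermArgs n r s (Defined F) (Defined G) (rev x) →
  ariTermV n r s (value F) (value G) x +q sign n *q ariTermV n r s (value F) (value G) (rev x)
    ≡ value F (fArg n r s x) *q value G (gArgA n r s s x) +q sign n *q (value F (fArg n r s (rev x)) *q value G (gArgA n r s s (rev x)))
ariTermV-rev-boundary n r s e F G sF sG x Ux Uo = ariTermV-rev n r s (value F) (value G) x hA hB
  where
  sgc : ∀ q → sign (r + s) *q q ≡ sign n *q q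
  sgc q = cong (λ z → sign z *q q) e
  oo : ∀ {m} (j : Fin m) → opposite (opposite j) ≡ j
  oo j = FP.opposite-involutive j
  hA : ∀ i → i < s → value F (fArg n r i (rev x)) *q value G (gArgA n r s i (rev x)) ≡ sign n *q (value F (fArg n r (suc (s ∸ suc i)) x) *q value G (gArgB n r s (suc (s ∸ suc i)) x))
  hA i i< = trans (skew-product r s _ _ _ _ eF eG) (sgc _)
    where
    k = s ∸ suc i
    ek : s ∸ i ≡ suc k
    ek = NP.+-∸-assoc 1 {s} {suc i} i<
    k< : k < s
    k< = NP.∸-monoʳ-< {s} {suc i} {0} (s≤s z≤n) i<
    eF = sF (fArg n r i (rev x)) (fArg n r (suc k) x)
            (λ j → sym (trans (fArg-rev n r s i x (opposite j) e (NP.<⇒≤ i<)) (trans (cong (λ z → fArg n r (s ∸ i) x z) (oo j)) (cong (λ z → fArg n r z x j) ek))))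
            (proj₁ (proj₁ Uo i (s≤s (NP.<⇒≤ i<)))) (proj₁ (proj₂ Ux k k<))
    eG = sG (gArgA n r s i (rev x)) (gArgB n r s (suc k) x)
            (λ j → sym (trans (gArgA-rev n r s i x (opposite j) e i<) (trans (cong (λ z → gArgB n r s (s ∸ i) x z) (oo j)) (cong (λ z → gArgB n r s z x j) ek))))
            (proj₂ (proj₁ Uo i (s≤s (NP.<⇒≤ i<)))) (proj₂ (proj₂ Ux k k<))
  hB : ∀ i → i < s → value F (fArg n r (suc i) (rev x)) *q value G (gArgB n r s (suc i) (rev x)) ≡ sign n *q (value F (fArg n r (s ∸ suc i) x) *q value G (gArgA n r s (s ∸ suc i) x))
  hB i i< = trans (skew-product r s _ _ _ _ eF eG) (sgc _)
    where
    k = s ∸ suc i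
    k≤ : k < suc s
    k≤ = s≤s (NP.m∸n≤m s (suc i))
    k< : k < s
    k< = NP.∸-monoʳ-< {s} {suc i} {0} (s≤s z≤n) i<
    sk : s ∸ k ≡ suc i
    sk = NP.m∸[m∸n]≡n i<
    eF = sF (fArg n r (suc i) (rev x)) (fArg n r k x)
            (λ j → sym (trans (fArg-rev n r s (suc i) x (opposite j) e i<) (cong (λ z → fArg n r k x z) (oo j))))
            (proj₁ (proj₂ Uo i i<)) (proj₁ (proj₁ Ux k k≤))
    eG = sG (gArgB n r s (suc i) (rev x)) (gArgA n r s k x)
            (λ j → trans (sym (gArgA-cong n r s k (rev-rev x) j)) (trans (gArgA-rev n r s k (rev x) j e k<) (cong (λ z → gArgB n r s z (rev x) (opposite j)) sk)))
            (proj₂ (proj₂ Uo i i<)) (proj₂ (proj₁ Ux k k≤))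

module _ (n : ℕ) (x : Point n) where
  private
    Φ Ψ : Seq → Seq → ℕ → ℕ → ℚ
    Φ f' g' a b = value (f' a) (lastPoint n a x) *q value (g' b) (firstPoint n b x)
    Ψ f' g' a b = value (f' a) (firstPoint n a x) *q value (g' b) (lastPoint n b x)

    boundary : Seq → Seq → ℚ
    boundary f' g' = ∑< (suc n) (λ r → Φ f' g' r (n ∸ r) +q Ψ f' g' r (n ∸ r))

  -- Reversing x pairs the terms of the first sum with those of the second, up to
  -- (−1)^n; only the last term i = s of the first sum is left, giving the boundary.
  ⊙ariV-rev : ∀ (F G : Seq) → (∀ r → φ-SkewValues (F r)) → (∀ r → φ-SkewValues (G r)) →
    AtArgs (DefinedP F) (DefinedP G) n x → AtArgs (DefinedP F) (DefinedP G) n (rev x) → AtArgs (DefinedP G) (DefinedP F) n x →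
    ⊙ariV (values F) (values G) n x +q sign n *q ⊙ariV (values F) (values G) n (rev x)
      ≡ boundary F G
  ⊙ariV-rev F G sF sG Ux Uo Vx =
    trans (cong (⊙ariV (values F) (values G) n x +q_) (sym (∑<-scale (suc n) (sign n) (λ r → sign n *q t r (rev x)) (λ r → t r (rev x)) (λ r _ → refl))))
      (trans (sym (∑<-+ (suc n) _ (λ r → t r x) (λ r → sign n *q t r (rev x)) (λ r _ → refl)))
        (∑<-cong (suc n) _ _ step))
    where
    t : ℕ → Point n → ℚ
    t r y = ariTermV n r (n ∸ r) (value (F r)) (value (G (n ∸ r))) y
    step : ∀ r → r < suc n → t r x +q sign n *q t r (rev x) ≡ Φ F G r (n ∸ r) +q Ψ F G r (n ∸ r)
    step r r< = trans (ariTermV-rev-boundary n r s e (F r) (G s) (sF r) (sG s) x (Ux r r<) (Uo r r<))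
                      (cong₂ _+q_ (cong (value (F r) (lastPoint n r x) *q_) (value-cong (G s) (gArgA-last n r s x))) second)
      where
      s = n ∸ r
      e : r + s ≡ n
      e = NP.m+[n∸m]≡n (NP.≤-pred r<)
      oo : ∀ {m} (j : Fin m) → opposite (opposite j) ≡ j
      oo j = FP.opposite-involutive j
      gFo : Defined (F r) (fArg n r s (rev x))
      gFo = proj₁ (proj₁ (Uo r r<) s NP.≤-refl)
      gFx : Defined (F r) (firstPoint n r x)
      gFx = proj₁ (proj₁ (Ux r r<) 0 (s≤s z≤n))
      gGo : Defined (G s) (firstPoint n s (rev x))
      gGo = Defined-cong (G s) (gArgA-last n r s (rev x)) (proj₂ (proj₁ (Uo r r<) s NP.≤-refl))
      gGx : Defined (G s) (lastPoint n s x)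
      gGx = proj₁ (proj₁ (Vx s (s≤s (NP.m∸n≤m n r))) (n ∸ s) NP.≤-refl)
      eF : value (F r) (lastPoint n r (rev x)) ≡ (-q sign r) *q value (F r) (firstPoint n r x)
      eF = sF r (lastPoint n r (rev x)) (firstPoint n r x)
              (λ j → sym (trans (lastPoint-rev n r x (opposite j) (NP.≤-pred r<)) (cong (firstPoint n r x) (oo j)))) gFo gFx
      eG : value (G s) (firstPoint n s (rev x)) ≡ (-q sign s) *q value (G s) (lastPoint n s x)
      eG = sG s (firstPoint n s (rev x)) (lastPoint n s x)
              (λ j → sym (trans (firstPoint-rev n s x (opposite j) (NP.m∸n≤m n r)) (cong (lastPoint n s x) (oo j)))) gGo gGx
      second : sign n *q (value (F r) (fArg n r s (rev x)) *q value (G s) (gArgA n r s s (rev x))) ≡ Ψ F G r s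
      second = trans (cong (λ z → sign n *q (value (F r) (fArg n r s (rev x)) *q z)) (value-cong (G s) (gArgA-last n r s (rev x))))
        (trans (cong (sign n *q_) (skew-product r s _ _ _ _ eF eG))
          (trans (cong (λ z → sign n *q (sign z *q Ψ F G r s)) e)
            (trans (sym (QP.*-assoc (sign n) (sign n) (Ψ F G r s))) (trans (cong (_*q Ψ F G r s) (sign-square n)) (QP.*-identityˡ _)))))

  ariV-φ-skew : ∀ (f g : Seq) → (∀ r → φ-SkewValues (f r)) → (∀ r → φ-SkewValues (g r)) →
    AtArgs (DefinedP f) (DefinedP g) n x → AtArgs (DefinedP f) (DefinedP g) n (rev x) → AtArgs (DefinedP g) (DefinedP f) n x → AtArgs (DefinedP g) (DefinedP f) n (rev x) →
    ariV (values f) (values g) n x +q sign n *q ariV (values f) (values g) n (rev x) ≡ 0ℚ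
  ariV-φ-skew f g skewF skewG U1 U2 U3 U4 =
    begin
      ariV (values f) (values g) n x +q sign n *q ariV (values f) (values g) n (rev x)
    ≡⟨ l (sign n) (⊙ariV (values f) (values g) n x) (⊙ariV (values g) (values f) n x)
                  (⊙ariV (values f) (values g) n (rev x)) (⊙ariV (values g) (values f) n (rev x)) ⟩
      (⊙ariV (values f) (values g) n x +q sign n *q ⊙ariV (values f) (values g) n (rev x))
        -q (⊙ariV (values g) (values f) n x +q sign n *q ⊙ariV (values g) (values f) n (rev x))
    ≡⟨ cong₂ _-q_ (⊙ariV-rev f g skewF skewG U1 U2 U3) (⊙ariV-rev g f skewG skewF U3 U4 U1) ⟩
      boundary f g -q boundary g f
    ≡⟨ cong (λ b → boundary f g -q b) boundary-swap ⟩
      boundary f g -q boundary f g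
    ≡⟨ QP.+-inverseʳ (boundary f g) ⟩
      0ℚ
    ∎
    where
    open ≡-Reasoning
    l : ∀ c a b a' b' → (a -q b) +q c *q (a' -q b') ≡ (a +q c *q a') -q (b +q c *q b')
    l = solve-∀ ℚ-ring
    boundary-swap : boundary g f ≡ boundary f g
    boundary-swap = trans (∑<-reverse (suc n) (λ r → Φ g f r (n ∸ r) +q Ψ g f r (n ∸ r)))
      (∑<-cong (suc n) _ _ λ r r< →
        trans (cong (λ z → Φ g f (n ∸ r) z +q Ψ g f (n ∸ r) z) (NP.m∸[m∸n]≡n (NP.≤-pred r<)))
              (trans (QP.+-comm (Φ g f (n ∸ r) r) (Ψ g f (n ∸ r) r))
                     (cong₂ _+q_ (QP.*-comm (value (g (n ∸ r)) (firstPoint n (n ∸ r) x)) (value (f r) (lastPoint n r x)))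
                                 (QP.*-comm (value (g (n ∸ r)) (lastPoint n (n ∸ r) x)) (value (f r) (firstPoint n r x))))))

ari-φ-skew : ∀ (f g : Seq) → WF f → WF g → (f +S φ f) ≈S zeroS → (g +S φ g) ≈S zeroS →
  (ari f g +S φ (ari f g)) ≈S zeroS
ari-φ-skew f g wf wg hf hg n = ≈R-from-values {p = P} {q = zeroR} (den P) nzP main
  where
  A : RatFun n
  A = ari f g n
  Arev : RatFun n
  Arev = substR (λ i → var (opposite i)) A
  P : RatFun n
  P = A +R φ (ari f g) n
  nzP : NonZeroP (den P)
  nzP = NonZeroP-⊗ (den A) (den (φ (ari f g) n)) (WF-ari f g wf wg n)
          (subst NonZeroP (sym (den-signR n Arev)) (NonZeroP-subst (λ i → var (opposite i)) surjective-reverse (den A) (WF-ari f g wf wg n)))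
  skewF : ∀ r → φ-SkewValues (f r)
  skewF r = φ-skew-values (f r) (φ-skew-component f hf r)
  skewG : ∀ r → φ-SkewValues (g r)
  skewG r = φ-skew-values (g r) (φ-skew-component g hg r)
  main : ∀ x → eval (den P) x ≢ 0ℚ → eval (num P) x *q eval (den zeroR) x ≡ eval (num zeroR) x *q eval (den P) x
  main x nz = value≡⇒cross {p = P} {q = zeroR} x nz (λ ()) (begin
      value P x
    ≡⟨ value-+ A (φ (ari f g) n) x nz ⟩
      value A x +q value (signR n Arev) x
    ≡⟨ cong (value A x +q_) (trans (value-sign n Arev x) (cong (sign n *q_) (value-subst (λ i → var (opposite i)) A x))) ⟩
      value A x +q sign n *q value A (rev x)
    ≡⟨ cong₂ (λ a b → a +q sign n *q b) (value-ari f g n x dx) (value-ari f g n (rev x) drx) ⟩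
      ariV (values f) (values g) n x +q sign n *q ariV (values f) (values g) n (rev x)
    ≡⟨ ariV-φ-skew n x f g skewF skewG (proj₁ argsx) (proj₁ argsrx) (proj₂ argsx) (proj₂ argsrx) ⟩
      0ℚ
    ≡⟨ sym (value-zero x) ⟩
      value zeroR x
    ∎)
    where
    open ≡-Reasoning
    dx : Defined A x
    dx = proj₁ (Defined-+ A (φ (ari f g) n) x nz)
    drx : Defined A (rev x)
    drx = Defined-subst (λ i → var (opposite i)) A x
            (λ e → proj₂ (Defined-+ A (φ (ari f g) n) x nz) (trans (cong (λ z → eval z x) (den-signR n Arev)) e))
    argsx : AtArgs (DefinedP f) (DefinedP g) n x × AtArgs (DefinedP g) (DefinedP f) n x
    argsx = Defined⇒AtArgs-ari f g n x dx
    argsrx : AtArgs (DefinedP f) (DefinedP g) n (rev x) × AtArgs (DefinedP g) (DefinedP f) n (rev x)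
    argsrx = Defined⇒AtArgs-ari f g n (rev x) drx

⊙ariV-0 : ∀ (vf vg : Values) → PointCong vf → PointCong vg → (x : Point 0) → ⊙ariV vf vg 0 x ≡ vf 0 (λ ()) *q vg 0 (λ ())
⊙ariV-0 vf vg cf cg x = trans (l (vf 0 (fArg 0 0 0 x)) (vg 0 (gArgA 0 0 0 0 x))) (cong₂ _*q_ (cf 0 (λ ())) (cg 0 (λ ())))
  where
  l : ∀ a b → ((a *q b +q 0ℚ) -q 0ℚ) +q 0ℚ ≡ a *q b
  l = solve-∀ ℚ-ring

ari-0 : ∀ (f g : Seq) → WF f → WF g → ari f g 0 ≈R zeroR
ari-0 f g wf wg = ≈R-from-values {p = ari f g 0} {q = zeroR} (den (ari f g 0)) (WF-ari f g wf wg 0) main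
  where
  main : ∀ x → eval (den (ari f g 0)) x ≢ 0ℚ → eval (num (ari f g 0)) x *q eval (den (zeroR {0})) x ≡ eval (num (zeroR {0})) x *q eval (den (ari f g 0)) x
  main x nz = value≡⇒cross {p = ari f g 0} {q = zeroR} x nz (λ ())
    (trans (value-ari f g 0 x nz)
      (trans (cong₂ _-q_ (⊙ariV-0 (values f) (values g) (values-cong f) (values-cong g) x) (⊙ariV-0 (values g) (values f) (values-cong g) (values-cong f) x))
        (trans (l (value (f 0) (λ ())) (value (g 0) (λ ()))) (sym (value-zero x)))))
    where
    l : ∀ a b → a *q b -q b *q a ≡ 0ℚ
    l = solve-∀ ℚ-ring

φ-Skew-𝒱 : ∀ f → InV f → ∀ r → φ-Skew (f r)
φ-Skew-𝒱 f v = φ-skew-component f (proj₂ v)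

InQ-ari : ∀ f g → InQ f → InQ g → InQ (ari f g)
InQ-ari f g (wf , lf , hf , ef) (wg , lg , hg , eg) =
  WF-ari f g wf wg , ariPairs lf lg , ariPairs-homogeneous lf lg hf hg ,
  ari-sumS f g lf lg wf wg (All.map proj₁ hf) (All.map proj₁ hg) ef eg

InV-ari : ∀ f g → InV f → InV g → InV (ari f g)
InV-ari f g ((qf , _) , skewF) ((qg , _) , skewG) =
  (InQ-ari f g qf qg , ari-0 f g (proj₁ qf) (proj₁ qg)) , ari-φ-skew f g (proj₁ qf) (proj₁ qg) skewF skewG

flat-ari-𝒱 : ∀ f g → InV f → InV g → flat (ari f g) ≈S ihara (flat f) (flat g)
flat-ari-𝒱 f g vf vg = flat-ari f g (φ-Skew-𝒱 f vf) (φ-Skew-𝒱 g vg)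

proposition4p5 :
    ((f g : Seq) → InV f → InV g →
      flat (ari f g) ≈S ihara (flat f) (flat g))
    × ((f g : Seq) → InV f → InV g →
      Σ Seq (λ h → InV h × flat h ≈S ihara (flat f) (flat g)))
    × ((f g : Seq) → InV f → InV g → flat f ≈S flat g → f ≈S g)
proposition4p5 =
  flat-ari-𝒱 ,
  (λ f g vf vg → ari f g , InV-ari f g vf vg , flat-ari-𝒱 f g vf vg) ,
  (λ f g _ _ → flat-injective f g)
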